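{- As formal power series in $t$, $$\sum_{n\geq1}\Big(\sum_{S}\binom{2n-1}{\mathrm{co}(S)}x^{|S|}\Big)2^{2n-1}\frac{t^{2n-1}}{(2n-1)!}=\frac{\sinh(2t)}{1-x(\cosh(2t)-1)},$$ $$\sum_{n\geq1}\Big(\sum_{S}\alpha^+_{2n-1}(S)\,x^{|S|}\Big)\frac{t^{2n-1}}{(2n-1)!}=\frac{\sinh t}{1-x(\cosh(2t)-1)},$$ where in both inner sums $S$ runs over all subsets of the set of odd integers in $[2n-2]$.
   Context: For $S=\{s_1<\cdots<s_k\}\subseteq[m-1]$, $\mathrm{co}(S)=(s_1,s_2-s_1,\dots,s_k-s_{k-1},m-s_k)$ and $\binom{m}{\mathrm{co}(S)}=m!/\big(s_1!(s_2-s_1)!\cdots(m-s_k)!\big)$. $\mathcal{B}^+_m$ is the set of signed permutations $\sigma$ of $\{\pm1,\dots,\pm m\}$ ($\sigma(-i)=-\sigma(i)$) with $\sigma(1)>0$, written as $\sigma(0)\sigma(1)\cdots\sigma(m)$ with $\sigma(0)=0$; a descent is a position $i\in\{0,\dots,m-1\}$ with $\sigma(i)>\sigma(i+1)$. For $S\subseteq[m-1]$, $\alpha^+_m(S)$ is the number of $\sigma\in\mathcal{B}^+_m$ whose descent set is contained in $S$. -}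

module Defs where

open import Data.Bool using (Bool; true; false; _∧_; if_then_else_; not; T?)
open import Data.Nat as ℕ using (ℕ; zero; suc; _∸_; _^_; NonZero; _≡ᵇ_; _!)
open import Data.Nat.Properties using (m*n≢0; _!≢0)

open import Data.Integer as ℤ using (ℤ; +_; ∣_∣)
open import Data.List using (List; []; _∷_; _++_; map; concatMap; foldr; length; filter; applyUpTo; upTo)
open import Data.Rational using (ℚ; 0ℚ; 1ℚ; _+_; _*_; -_; _/_)
open import Relation.Nullary.Decidable using (does)

Σℚ : List ℚ → ℚ
Σℚ = foldr _+_ 0ℚ

sublists : {A : Set} → List A → List (List A)
sublists []       = [] ∷ []
sublists (a ∷ as) = sublists as ++ map (a ∷_) (sublists as)

words : {A : Set} → ℕ → List A → List (List A)
words zero    L = [] ∷ []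
words (suc k) L = concatMap (λ a → map (a ∷_) (words k L)) L

-- co(S) for S = s₁ < ... < s_k ⊆ [m-1] given as an increasing list
coAux : ℕ → ℕ → List ℕ → List ℕ
coAux m prev []       = (m ∸ prev) ∷ []
coAux m prev (s ∷ ss) = (s ∸ prev) ∷ coAux m s ss

co : ℕ → List ℕ → List ℕ
co m S = coAux m 0 S

prodFact : List ℕ → ℕ
prodFact []       = 1
prodFact (a ∷ as) = a ! ℕ.* prodFact as

prodFact≢0 : ∀ as → NonZero (prodFact as)
prodFact≢0 []       = _
prodFact≢0 (a ∷ as) = m*n≢0 (a !) (prodFact as) {{a !≢0}} {{prodFact≢0 as}}

multinom : ℕ → List ℕ → ℚ
multinom m S = (+ (m !)) / prodFact (co m S)
  where instance _ = prodFact≢0 (co m S)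

signedAlphabet : ℕ → List ℤ
signedAlphabet m = concatMap (λ i → + i ∷ ℤ.- (+ i) ∷ []) (applyUpTo suc m)

memℕ : ℕ → List ℕ → Bool
memℕ x []       = false
memℕ x (y ∷ ys) = (x ≡ᵇ y) Data.Bool.∨ memℕ x ys

distinct : List ℕ → Bool
distinct []       = true
distinct (x ∷ xs) = not (memℕ x xs) ∧ distinct xs

-- a word σ(1)…σ(m) over {±1,…,±m} is (the window of) a signed permutation
-- iff |σ(1)|,…,|σ(m)| are pairwise distinct (hence a permutation of [m])
isSignedPerm : List ℤ → Bool
isSignedPerm w = distinct (map ∣_∣ w)

firstPositive : List ℤ → Bool
firstPositive []      = false
firstPositive (a ∷ _) = does (+ 0 ℤ.<? a)

-- descent positions of σ(0)σ(1)…σ(m) with σ(0)=0, positions counted from i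
descAux : ℕ → List ℤ → List ℕ
descAux i []           = []
descAux i (a ∷ [])     = []
descAux i (a ∷ b ∷ w)  = (if does (b ℤ.<? a) then (i ∷ []) else []) ++ descAux (suc i) (b ∷ w)

descentSet : List ℤ → List ℕ
descentSet w = descAux 0 (+ 0 ∷ w)

Bplus : ℕ → List (List ℤ)
Bplus m = filter (λ w → T? (isSignedPerm w ∧ firstPositive w)) (words m (signedAlphabet m))

descIn : List ℕ → List ℤ → Bool
descIn S w = allIn (descentSet w)
  where
    allIn : List ℕ → Bool
    allIn []       = true
    allIn (d ∷ ds) = memℕ d S ∧ allIn ds

alphaPlus : ℕ → List ℕ → ℕ
alphaPlus m S = length (filter (λ w → T? (descIn S w)) (Bplus m))

-- Formal power series in t with coefficients in ℚ[x], represented by the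
-- coefficient function  F k m = [x^k t^m] F.

Series : Set
Series = ℕ → ℕ → ℚ

_⋆_ : Series → Series → Series
(f ⋆ g) k m = Σℚ (map (λ i → Σℚ (map (λ j → f i j * g (k ∸ i) (m ∸ j)) (upTo (suc m)))) (upTo (suc k)))

-- g ↦ the sequence whose (2n-1)-st term is g n (n ≥ 1), even terms 0
oddSeq : (ℕ → ℚ) → ℕ → ℚ
oddSeq g zero          = 0ℚ
oddSeq g (suc zero)    = g 1
oddSeq g (suc (suc m)) = oddSeq (λ n → g (suc n)) m

isOdd : ℕ → Bool
isOdd zero          = false
isOdd (suc zero)    = true
isOdd (suc (suc m)) = isOdd m

isEvenPos : ℕ → Bool
isEvenPos zero          = false
isEvenPos (suc zero)    = false
isEvenPos (suc (suc m)) = not (isOdd m)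

oddsBelow : ℕ → List ℕ
oddsBelow n = applyUpTo (λ i → suc (2 ℕ.* i)) (n ∸ 1)

sumOverOddSubsets : ℕ → ℕ → (List ℕ → ℚ) → ℚ
sumOverOddSubsets n k f =
  Σℚ (map f (filter (λ S → T? (length S ≡ᵇ k)) (sublists (oddsBelow n))))

_over!_ : ℕ → ℕ → ℚ
c over! m = (+ c) / (m !)
  where instance _ = m !≢0

LHS₁ : Series
LHS₁ k = oddSeq (λ n → sumOverOddSubsets n k
                  (λ S → multinom (2 ℕ.* n ∸ 1) S * (2 ^ (2 ℕ.* n ∸ 1)) over! (2 ℕ.* n ∸ 1)))

LHS₂ : Series
LHS₂ k = oddSeq (λ n → sumOverOddSubsets n k
                  (λ S → alphaPlus (2 ℕ.* n ∸ 1) S over! (2 ℕ.* n ∸ 1)))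

sinh2t : Series
sinh2t zero    m = if isOdd m then (2 ^ m) over! m else 0ℚ
sinh2t (suc k) m = 0ℚ

sinht : Series
sinht zero    m = if isOdd m then 1 over! m else 0ℚ
sinht (suc k) m = 0ℚ

denom : Series
denom zero          zero = 1ℚ
denom zero          (suc m) = 0ℚ
denom (suc zero)    m = if isEvenPos m then - ((2 ^ m) over! m) else 0ℚ
denom (suc (suc k)) m = 0ℚ

-- Comparing coefficients of x^j, each identity says that the x-free part of the left side is the
-- sinh series and that its x^(j+1)-part is its x^j-part times cosh 2t − 1.  Both inner sums run over
-- chains S of odd numbers with a weight that, at the last element s of S, factors off 2^(m−s)/(m−s)!;
-- as m − s is even and positive, splitting off max S gives exactly that recurrence.  For the first
-- series the weight is 2^m / ∏ co(S)!.  For the second it is α⁺_m(S)/m! = 2^(m−s₁) / ∏ co(S)!, where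
-- s₁ = min S: inserting ±m into a signed permutation of [m−1] creates a descent just after +m or just
-- before −m, which yields a Pascal-type recurrence for the number of signed permutations whose descents
-- lie at the block starts of a composition.

module Submission where

open import Defs
open import Algebra.Bundles using (CommutativeSemigroup)
open import Algebra.Structures using (IsCommutativeMonoid)
open import Level using (0ℓ)
open import Data.Bool using (Bool; true; false; _∧_; _∨_; not; if_then_else_; T; T?)
import Data.Bool.Properties as BP
open import Data.Empty using (⊥-elim)
open import Data.Integer using (ℤ; -[1+_]; ∣_∣)
open import Agda.Builtin.Int using (pos)
import Data.Integer as Z
import Data.Integer.Properties as ZP
open import Data.List using (List; []; _∷_; _++_; map; concatMap; foldr; length; filter; applyUpTo; upTo; replicate)
import Data.List.Properties as LP
open import Data.List.Relation.Unary.All as All using (All; []; _∷_)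
import Data.List.Relation.Unary.All.Properties as AllP
open import Data.Nat using (ℕ; zero; suc; _+_; _*_; _∸_; _^_; _≤_; _<_; z≤n; s≤s; _≡ᵇ_; _!; NonZero)
import Data.Nat.Properties as NP
open NP using (_!≢0)
open import Data.Nat.Solver using (module +-*-Solver)
open import Data.Product using (Σ; _×_; _,_)
open import Data.Sum using (_⊎_; inj₁; inj₂)
open import Data.Unit using (tt)
import Data.Rational as Q
import Data.Rational.Properties as QP
import Data.Rational.Unnormalised as U
import Data.Rational.Unnormalised.Properties as UP
open import Function using (_∘_)
open import Relation.Binary.PropositionalEquality
open import Relation.Nullary using (does)
open import Relation.Nullary.Decidable using (dec-true; dec-false)
open Q using () renaming (_+_ to _+q_; _*_ to _*q_; -_ to -q_; 0ℚ to 0q)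
open +-*-Solver

module ListSum {R : Set} {_⊕_ : R → R → R} {ε : R}
               (isCM : IsCommutativeMonoid {A = R} _≡_ _⊕_ ε) where
  open IsCommutativeMonoid isCM using (assoc; identityˡ; identityʳ; isCommutativeSemigroup)
  open ≡-Reasoning

  private
    commutativeSemigroup : CommutativeSemigroup 0ℓ 0ℓ
    commutativeSemigroup = record { isCommutativeSemigroup = isCommutativeSemigroup }

  open import Algebra.Properties.CommutativeSemigroup commutativeSemigroup using (interchange)

  sum : {A : Set} → List A → (A → R) → R
  sum xs f = foldr _⊕_ ε (map f xs)

  sum-++ : {A : Set} (xs ys : List A) (f : A → R) → sum (xs ++ ys) f ≡ sum xs f ⊕ sum ys f
  sum-++ []       ys f = sym (identityˡ _)
  sum-++ (x ∷ xs) ys f = trans (cong (f x ⊕_) (sum-++ xs ys f)) (sym (assoc (f x) _ _))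

  sum-map : {A B : Set} (g : A → B) (xs : List A) (f : B → R) → sum (map g xs) f ≡ sum xs (f ∘ g)
  sum-map g xs f = cong (foldr _⊕_ ε) (sym (LP.map-∘ xs))

  sum-concatMap : {A B : Set} (g : A → List B) (xs : List A) (f : B → R) →
                  sum (concatMap g xs) f ≡ sum xs (λ x → sum (g x) f)
  sum-concatMap g []       f = refl
  sum-concatMap g (x ∷ xs) f =
    trans (sum-++ (g x) (concatMap g xs) f) (cong (sum (g x) f ⊕_) (sum-concatMap g xs f))

  sum-cong-All : {A : Set} {P : A → Set} {xs : List A} {f g : A → R} →
                 All P xs → (∀ x → P x → f x ≡ g x) → sum xs f ≡ sum xs g
  sum-cong-All []       e = refl
  sum-cong-All (p ∷ ps) e = cong₂ _⊕_ (e _ p) (sum-cong-All ps e)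

  sum-cong : {A : Set} (xs : List A) {f g : A → R} → (∀ x → f x ≡ g x) → sum xs f ≡ sum xs g
  sum-cong []       e = refl
  sum-cong (x ∷ xs) e = cong₂ _⊕_ (e x) (sum-cong xs e)

  sum-zero : {A : Set} (xs : List A) {f : A → R} → (∀ x → f x ≡ ε) → sum xs f ≡ ε
  sum-zero []       e = refl
  sum-zero (x ∷ xs) e = trans (cong₂ _⊕_ (e x) (sum-zero xs e)) (identityˡ ε)

  sum-zero-All : {A : Set} {P : A → Set} {xs : List A} {f : A → R} → All P xs → (∀ x → P x → f x ≡ ε) → sum xs f ≡ ε
  sum-zero-All {xs = xs} ps e = trans (sum-cong-All ps e) (sum-zero xs (λ _ → refl))

  sum-distrib : {A : Set} (xs : List A) (f g : A → R) → sum xs (λ x → f x ⊕ g x) ≡ sum xs f ⊕ sum xs g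
  sum-distrib []       f g = sym (identityˡ ε)
  sum-distrib (x ∷ xs) f g = trans (cong ((f x ⊕ g x) ⊕_) (sum-distrib xs f g)) (interchange (f x) (g x) _ _)

  sum-homo : {A : Set} (h : R → R) → h ε ≡ ε → (∀ a b → h (a ⊕ b) ≡ h a ⊕ h b) →
             (xs : List A) (f : A → R) → h (sum xs f) ≡ sum xs (h ∘ f)
  sum-homo h h-ε h-⊕ []       f = h-ε
  sum-homo h h-ε h-⊕ (x ∷ xs) f = trans (h-⊕ (f x) _) (cong (h (f x) ⊕_) (sum-homo h h-ε h-⊕ xs f))

  sum-filter : {A : Set} (p : A → Bool) (xs : List A) (f : A → R) →
               sum (filter (T? ∘ p) xs) f ≡ sum xs (λ x → if p x then f x else ε)
  sum-filter p []       f = refl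
  sum-filter p (x ∷ xs) f with p x
  ... | true  = cong (f x ⊕_) (sum-filter p xs f)
  ... | false = trans (sum-filter p xs f) (sym (identityˡ _))

  sum-upTo-suc : (n : ℕ) (f : ℕ → R) → sum (upTo (suc n)) f ≡ sum (upTo n) f ⊕ f n
  sum-upTo-suc n f = begin
    sum (upTo (suc n)) f           ≡⟨ cong (λ l → sum l f) (sym (LP.upTo-∷ʳ n)) ⟩
    sum (upTo n ++ n ∷ []) f       ≡⟨ sum-++ (upTo n) (n ∷ []) f ⟩
    sum (upTo n) f ⊕ (f n ⊕ ε)     ≡⟨ cong (sum (upTo n) f ⊕_) (identityʳ (f n)) ⟩
    sum (upTo n) f ⊕ f n           ∎

  sum-upTo-cong : (n : ℕ) {f g : ℕ → R} → (∀ i → i < n → f i ≡ g i) → sum (upTo n) f ≡ sum (upTo n) g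
  sum-upTo-cong n = sum-cong-All (AllP.all-upTo n)

  sum-upTo-zero : (n : ℕ) {f : ℕ → R} → (∀ i → i < n → f i ≡ ε) → sum (upTo n) f ≡ ε
  sum-upTo-zero n = sum-zero-All (AllP.all-upTo n)

  sum-upTo-pairs : (k : ℕ) (f : ℕ → R) → sum (upTo (2 * k)) f ≡ sum (upTo k) (λ i → f (2 * i) ⊕ f (suc (2 * i)))
  sum-upTo-pairs zero    f = refl
  sum-upTo-pairs (suc k) f = begin
      sum (upTo (2 * suc k)) f
    ≡⟨ cong (λ n → sum (upTo n) f) (NP.*-suc 2 k) ⟩
      sum (upTo (suc (suc (2 * k)))) f
    ≡⟨ trans (sum-upTo-suc (suc (2 * k)) f) (cong (_⊕ f (suc (2 * k))) (sum-upTo-suc (2 * k) f)) ⟩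
      (sum (upTo (2 * k)) f ⊕ f (2 * k)) ⊕ f (suc (2 * k))
    ≡⟨ assoc _ _ _ ⟩
      sum (upTo (2 * k)) f ⊕ (f (2 * k) ⊕ f (suc (2 * k)))
    ≡⟨ cong (_⊕ (f (2 * k) ⊕ f (suc (2 * k)))) (sum-upTo-pairs k f) ⟩
      sum (upTo k) (λ i → f (2 * i) ⊕ f (suc (2 * i))) ⊕ (f (2 * k) ⊕ f (suc (2 * k)))
    ≡⟨ sym (sum-upTo-suc k _) ⟩
      sum (upTo (suc k)) (λ i → f (2 * i) ⊕ f (suc (2 * i)))
    ∎

  sum-sublists-∷ʳ : {A : Set} (xs : List A) (x : A) (F : List A → R) →
    sum (sublists (xs ++ x ∷ [])) F ≡ sum (sublists xs) F ⊕ sum (sublists xs) (λ S → F (S ++ x ∷ []))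
  sum-sublists-∷ʳ {A} []       x F = cong (_⊕ (F (x ∷ []) ⊕ ε)) (sym (identityʳ (F [])))
  sum-sublists-∷ʳ {A} (a ∷ xs) x F = begin
      sum (sublists ((a ∷ xs) ++ x ∷ [])) F
    ≡⟨ split (xs ++ x ∷ []) F ⟩
      sum (sublists (xs ++ x ∷ [])) F ⊕ sum (sublists (xs ++ x ∷ [])) (F ∘ (a ∷_))
    ≡⟨ cong₂ _⊕_ (sum-sublists-∷ʳ xs x F) (sum-sublists-∷ʳ xs x (F ∘ (a ∷_))) ⟩
      (sum (sublists xs) F ⊕ sum (sublists xs) (λ S → F (S ++ x ∷ [])))
        ⊕ (sum (sublists xs) (F ∘ (a ∷_)) ⊕ sum (sublists xs) (λ S → F (a ∷ S ++ x ∷ [])))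
    ≡⟨ interchange _ _ _ _ ⟩
      (sum (sublists xs) F ⊕ sum (sublists xs) (F ∘ (a ∷_)))
        ⊕ (sum (sublists xs) (λ S → F (S ++ x ∷ [])) ⊕ sum (sublists xs) (λ S → F (a ∷ S ++ x ∷ [])))
    ≡⟨ sym (cong₂ _⊕_ (split xs F) (split xs (λ S → F (S ++ x ∷ [])))) ⟩
      sum (sublists (a ∷ xs)) F ⊕ sum (sublists (a ∷ xs)) (λ S → F (S ++ x ∷ []))
    ∎
    where
    split : (ys : List A) (G : List A → R) → sum (sublists (a ∷ ys)) G ≡ sum (sublists ys) G ⊕ sum (sublists ys) (G ∘ (a ∷_))
    split ys G = trans (sum-++ (sublists ys) _ G) (cong (sum (sublists ys) G ⊕_) (sum-map (a ∷_) (sublists ys) G))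

open module ℕ-Sum = ListSum NP.+-0-isCommutativeMonoid using () renaming (sum to sumℕ)
open module ℚ-Sum = ListSum QP.+-0-isCommutativeMonoid using () renaming (sum to sumℚ)

sumℕ-*ˡ : {A : Set} (xs : List A) (c : ℕ) (f : A → ℕ) → sumℕ xs (λ x → c * f x) ≡ c * sumℕ xs f
sumℕ-*ˡ xs c f = sym (ℕ-Sum.sum-homo (c *_) (NP.*-zeroʳ c) (NP.*-distribˡ-+ c) xs f)

⟪_⟫ : Bool → ℕ
⟪ true ⟫  = 1
⟪ false ⟫ = 0

⟪∧⟫ : ∀ a b → ⟪ a ∧ b ⟫ ≡ ⟪ a ⟫ * ⟪ b ⟫
⟪∧⟫ true  b = sym (NP.+-identityʳ ⟪ b ⟫)
⟪∧⟫ false b = refl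

length-filter : {A : Set} (p : A → Bool) (xs : List A) → length (filter (T? ∘ p) xs) ≡ sumℕ xs (⟪_⟫ ∘ p)
length-filter p []       = refl
length-filter p (x ∷ xs) with p x
... | true  = cong suc (length-filter p xs)
... | false = length-filter p xs

sumℕ-filter : {A : Set} (p : A → Bool) (xs : List A) (f : A → ℕ) →
              sumℕ (filter (T? ∘ p) xs) f ≡ sumℕ xs (λ x → ⟪ p x ⟫ * f x)
sumℕ-filter p []       f = refl
sumℕ-filter p (x ∷ xs) f with p x
... | true  = cong₂ _+_ (sym (NP.+-identityʳ (f x))) (sumℕ-filter p xs f)
... | false = sumℕ-filter p xs f

≡ᵇ-refl : ∀ n → (n ≡ᵇ n) ≡ true
≡ᵇ-refl zero    = refl
≡ᵇ-refl (suc n) = ≡ᵇ-refl n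

≢⇒≡ᵇ-false : ∀ m n → m ≢ n → (m ≡ᵇ n) ≡ false
≢⇒≡ᵇ-false m n m≢n with m ≡ᵇ n in eq
... | true  = ⊥-elim (m≢n (NP.≡ᵇ⇒≡ m n (subst T (sym eq) tt)))
... | false = refl

memℕ-false : ∀ j xs → All (j <_) xs → memℕ j xs ≡ false
memℕ-false j []       []        = refl
memℕ-false j (x ∷ xs) (j<x ∷ ps) =
  trans (cong (_∨ memℕ j xs) (≢⇒≡ᵇ-false j x (λ e → NP.<-irrefl e j<x))) (memℕ-false j xs ps)

absFresh : ℕ → List ℤ → Bool
absFresh x w = not (memℕ x (map ∣_∣ w))

onSignedPerms : (List ℤ → ℕ) → List ℤ → ℕ
onSignedPerms g w = ⟪ isSignedPerm w ⟫ * g w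

sumInsertions : ℤ → (List ℤ → ℕ) → List ℤ → ℕ
sumInsertions z g []      = g (z ∷ [])
sumInsertions z g (b ∷ u) = g (z ∷ b ∷ u) + sumInsertions z (g ∘ (b ∷_)) u

sumInsertions-cong : ∀ z u {g h : List ℤ → ℕ} → (∀ v → g v ≡ h v) → sumInsertions z g u ≡ sumInsertions z h u
sumInsertions-cong z []      e = e _
sumInsertions-cong z (b ∷ u) e = cong₂ _+_ (e _) (sumInsertions-cong z u (e ∘ (b ∷_)))

sumInsertions-*ˡ : ∀ z u c (g : List ℤ → ℕ) → sumInsertions z (λ v → c * g v) u ≡ c * sumInsertions z g u
sumInsertions-*ˡ z []      c g = refl
sumInsertions-*ˡ z (b ∷ u) c g =
  trans (cong (c * g (z ∷ b ∷ u) +_) (sumInsertions-*ˡ z u c (g ∘ (b ∷_)))) (sym (NP.*-distribˡ-+ c _ _))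

sumInsertions-absFresh : ∀ x z (h : List ℤ → ℕ) u → (x ≡ᵇ ∣ z ∣) ≡ false →
  sumInsertions z (λ v → ⟪ absFresh x v ⟫ * h v) u ≡ ⟪ absFresh x u ⟫ * sumInsertions z h u
sumInsertions-absFresh x z h [] e rewrite e = refl
sumInsertions-absFresh x z h (b ∷ u) e with x ≡ᵇ ∣ b ∣
... | true  = cong₂ _+_ (cong (λ t → ⟪ not (t ∨ true) ⟫ * h (z ∷ b ∷ u)) e)
                        (sumInsertions-*ˡ z u 0 (h ∘ (b ∷_)))
... | false = trans (cong₂ _+_ (cong (λ t → ⟪ not (t ∨ memℕ x (map ∣_∣ u)) ⟫ * h (z ∷ b ∷ u)) e)
                               (sumInsertions-absFresh x z (h ∘ (b ∷_)) u e))
                    (sym (NP.*-distribˡ-+ ⟪ absFresh x u ⟫ _ _))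

-- Empty, not [ [] ], for L = 0: a word of length 0 contains no inserted letter.
wordsOfPredLength : ℕ → List ℤ → List (List ℤ)
wordsOfPredLength zero    A = []
wordsOfPredLength (suc L) A = words L A

sum-words-suc : ∀ L (A : List ℤ) (f : List ℤ → ℕ) →
                sumℕ (words (suc L) A) f ≡ sumℕ A (λ a → sumℕ (words L A) (f ∘ (a ∷_)))
sum-words-suc L A f = trans (ℕ-Sum.sum-concatMap (λ a → map (a ∷_) (words L A)) A f)
                            (ℕ-Sum.sum-cong A (λ a → ℕ-Sum.sum-map (a ∷_) (words L A) f))

sum-words-cong : ∀ {P : ℤ → Set} L (A : List ℤ) → All P A → {f g : List ℤ → ℕ} →
                 (∀ w → All P w → length w ≡ L → f w ≡ g w) → sumℕ (words L A) f ≡ sumℕ (words L A) g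
sum-words-cong zero    A pA e = cong (_+ 0) (e [] [] refl)
sum-words-cong (suc L) A pA {f} {g} e =
  trans (sum-words-suc L A f)
  (trans (ℕ-Sum.sum-cong-All pA (λ a p → sum-words-cong L A pA (λ w pw lw → e (a ∷ w) (p ∷ pw) (cong suc lw))))
         (sym (sum-words-suc L A g)))

sum-words-absFresh : ∀ M (A zs : List ℤ) → All (λ a → (M ≡ᵇ ∣ a ∣) ≡ false) A → All (λ z → (M ≡ᵇ ∣ z ∣) ≡ true) zs →
  ∀ L (h : List ℤ → ℕ) → sumℕ (words L (A ++ zs)) (λ w → ⟪ absFresh M w ⟫ * h w) ≡ sumℕ (words L A) h
sum-words-absFresh M A zs hA hz zero    h = cong (_+ 0) (NP.+-identityʳ (h []))
sum-words-absFresh M A zs hA hz (suc L) h = begin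
    sumℕ (words (suc L) (A ++ zs)) (λ w → ⟪ absFresh M w ⟫ * h w)
  ≡⟨ trans (sum-words-suc L (A ++ zs) _) (ℕ-Sum.sum-++ A zs _) ⟩
    sumℕ A (λ a → sumℕ (words L (A ++ zs)) (λ w → ⟪ absFresh M (a ∷ w) ⟫ * h (a ∷ w)))
      + sumℕ zs (λ z → sumℕ (words L (A ++ zs)) (λ w → ⟪ absFresh M (z ∷ w) ⟫ * h (z ∷ w)))
  ≡⟨ cong₂ _+_ (ℕ-Sum.sum-cong-All hA old) (ℕ-Sum.sum-zero-All hz new) ⟩
    sumℕ A (λ a → sumℕ (words L A) (h ∘ (a ∷_))) + 0
  ≡⟨ trans (NP.+-identityʳ _) (sym (sum-words-suc L A h)) ⟩
    sumℕ (words (suc L) A) h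
  ∎
  where
  open ≡-Reasoning
  old : ∀ a → (M ≡ᵇ ∣ a ∣) ≡ false →
        sumℕ (words L (A ++ zs)) (λ w → ⟪ absFresh M (a ∷ w) ⟫ * h (a ∷ w)) ≡ sumℕ (words L A) (h ∘ (a ∷_))
  old a e = trans (ℕ-Sum.sum-cong (words L (A ++ zs))
                    (λ w → cong (λ t → ⟪ not (t ∨ memℕ M (map ∣_∣ w)) ⟫ * h (a ∷ w)) e))
                  (sum-words-absFresh M A zs hA hz L (h ∘ (a ∷_)))
  new : ∀ z → (M ≡ᵇ ∣ z ∣) ≡ true →
        sumℕ (words L (A ++ zs)) (λ w → ⟪ absFresh M (z ∷ w) ⟫ * h (z ∷ w)) ≡ 0
  new z e = ℕ-Sum.sum-zero (words L (A ++ zs))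
              (λ w → cong (λ t → ⟪ not (t ∨ memℕ M (map ∣_∣ w)) ⟫ * h (z ∷ w)) e)

-- A signed permutation over A ++ z₁ ∷ z₂ ∷ [] either avoids z₁ and z₂, or arises from a unique
-- insertion of one of them into a signed permutation over A.
module ExtendAlphabet (M : ℕ) (A : List ℤ) (z₁ z₂ : ℤ) (hA : All (λ a → ∣ a ∣ ≢ M) A)
                      (h₁ : ∣ z₁ ∣ ≡ M) (h₂ : ∣ z₂ ∣ ≡ M) where

  insertEither : (List ℤ → ℕ) → List ℤ → ℕ
  insertEither g u = sumInsertions z₁ g u + sumInsertions z₂ g u

  insertionTerm : (List ℤ → ℕ) → ℕ → ℕ
  insertionTerm g L = sumℕ (wordsOfPredLength L A) (λ u → ⟪ isSignedPerm u ⟫ * insertEither g u)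

  private
    B : List ℤ
    B = A ++ z₁ ∷ z₂ ∷ []

    afterFresh : (List ℤ → ℕ) → ℤ → List ℤ → ℕ
    afterFresh g a w = ⟪ absFresh ∣ a ∣ w ⟫ * g (a ∷ w)

    onSignedPerms-∷ : ∀ g a w → onSignedPerms g (a ∷ w) ≡ onSignedPerms (afterFresh g a) w
    onSignedPerms-∷ g a w = trans (cong (_* g (a ∷ w)) (⟪∧⟫ (absFresh ∣ a ∣ w) (isSignedPerm w)))
                                  (lem ⟪ absFresh ∣ a ∣ w ⟫ ⟪ isSignedPerm w ⟫ (g (a ∷ w)))
      where
      lem : ∀ x y z → x * y * z ≡ y * (x * z)
      lem = solve 3 (λ x y z → x :* y :* z := y :* (x :* z)) refl

    onSignedPerms-∷-new : ∀ g z w → ∣ z ∣ ≡ M → onSignedPerms g (z ∷ w) ≡ ⟪ absFresh M w ⟫ * onSignedPerms (g ∘ (z ∷_)) w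
    onSignedPerms-∷-new g z w refl = trans (cong (_* g (z ∷ w)) (⟪∧⟫ (absFresh ∣ z ∣ w) (isSignedPerm w)))
                                           (NP.*-assoc ⟪ absFresh ∣ z ∣ w ⟫ _ _)

    M≡ᵇ : ∀ z → ∣ z ∣ ≡ M → (M ≡ᵇ ∣ z ∣) ≡ true
    M≡ᵇ z e = subst (λ t → (t ≡ᵇ ∣ z ∣) ≡ true) e (≡ᵇ-refl ∣ z ∣)

    startingWith : (List ℤ → ℕ) → ℕ → ℤ → ℕ
    startingWith g L z = sumℕ (words L A) (onSignedPerms (g ∘ (z ∷_)))

    sum-startingWith : ∀ g L z → ∣ z ∣ ≡ M → sumℕ (words L B) (onSignedPerms g ∘ (z ∷_)) ≡ startingWith g L z
    sum-startingWith g L z e =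
      trans (ℕ-Sum.sum-cong (words L B) (λ w → onSignedPerms-∷-new g z w e))
            (sum-words-absFresh M A (z₁ ∷ z₂ ∷ [])
              (All.map (λ ne → ≢⇒≡ᵇ-false _ _ (ne ∘ sym)) hA) (M≡ᵇ z₁ h₁ ∷ M≡ᵇ z₂ h₂ ∷ []) L (onSignedPerms (g ∘ (z ∷_))))

    insertEither-∷ : ∀ g a u → ∣ a ∣ ≢ M →
      ⟪ isSignedPerm u ⟫ * insertEither (afterFresh g a) u + (onSignedPerms (g ∘ (z₁ ∷_)) (a ∷ u) + onSignedPerms (g ∘ (z₂ ∷_)) (a ∷ u))
        ≡ ⟪ isSignedPerm (a ∷ u) ⟫ * insertEither g (a ∷ u)
    insertEither-∷ g a u ne
      rewrite sumInsertions-absFresh ∣ a ∣ z₁ (g ∘ (a ∷_)) u (≢⇒≡ᵇ-false ∣ a ∣ ∣ z₁ ∣ (λ e → ne (trans e h₁)))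
            | sumInsertions-absFresh ∣ a ∣ z₂ (g ∘ (a ∷_)) u (≢⇒≡ᵇ-false ∣ a ∣ ∣ z₂ ∣ (λ e → ne (trans e h₂)))
            | ⟪∧⟫ (absFresh ∣ a ∣ u) (isSignedPerm u)
      = lem ⟪ absFresh ∣ a ∣ u ⟫ ⟪ isSignedPerm u ⟫ (g (z₁ ∷ a ∷ u)) (g (z₂ ∷ a ∷ u))
            (sumInsertions z₁ (g ∘ (a ∷_)) u) (sumInsertions z₂ (g ∘ (a ∷_)) u)
      where
      lem : ∀ s t G₁ G₂ J₁ J₂ → t * (s * J₁ + s * J₂) + (s * t * G₁ + s * t * G₂) ≡ s * t * ((G₁ + J₁) + (G₂ + J₂))
      lem = solve 6 (λ s t G₁ G₂ J₁ J₂ → t :* (s :* J₁ :+ s :* J₂) :+ (s :* t :* G₁ :+ s :* t :* G₂)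
                                         := s :* t :* ((G₁ :+ J₁) :+ (G₂ :+ J₂))) refl

    insertionTerm-suc : ∀ L g → sumℕ A (λ a → insertionTerm (afterFresh g a) L) + (startingWith g L z₁ + (startingWith g L z₂ + 0))
                                ≡ insertionTerm g (suc L)
    insertionTerm-suc zero g =
      trans (cong (_+ (startingWith g zero z₁ + (startingWith g zero z₂ + 0))) (ℕ-Sum.sum-zero A {λ a → insertionTerm (afterFresh g a) zero} (λ _ → refl)))
            (lem (g (z₁ ∷ [])) (g (z₂ ∷ [])))
      where
      lem : ∀ x y → 0 + ((1 * x + 0) + ((1 * y + 0) + 0)) ≡ 1 * (x + y) + 0
      lem = solve 2 (λ x y → con 0 :+ ((con 1 :* x :+ con 0) :+ ((con 1 :* y :+ con 0) :+ con 0)) := con 1 :* (x :+ y) :+ con 0) refl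
    insertionTerm-suc (suc L) g = begin
        sumℕ A (λ a → insertionTerm (afterFresh g a) (suc L)) + (startingWith g (suc L) z₁ + (startingWith g (suc L) z₂ + 0))
      ≡⟨ cong (sumℕ A (λ a → insertionTerm (afterFresh g a) (suc L)) +_)
              (trans (cong (startingWith g (suc L) z₁ +_) (NP.+-identityʳ _))
                     (cong₂ _+_ (sum-words-suc L A _) (sum-words-suc L A _))) ⟩
        sumℕ A (λ a → insertionTerm (afterFresh g a) (suc L)) + (sumℕ A (start z₁) + sumℕ A (start z₂))
      ≡⟨ cong (sumℕ A (λ a → insertionTerm (afterFresh g a) (suc L)) +_) (sym (ℕ-Sum.sum-distrib A (start z₁) (start z₂))) ⟩
        sumℕ A (λ a → insertionTerm (afterFresh g a) (suc L)) + sumℕ A (λ a → start z₁ a + start z₂ a)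
      ≡⟨ sym (ℕ-Sum.sum-distrib A _ _) ⟩
        sumℕ A (λ a → insertionTerm (afterFresh g a) (suc L) + (start z₁ a + start z₂ a))
      ≡⟨ ℕ-Sum.sum-cong-All hA firstLetter ⟩
        sumℕ A (λ a → sumℕ (words L A) (λ u → ⟪ isSignedPerm (a ∷ u) ⟫ * insertEither g (a ∷ u)))
      ≡⟨ sym (sum-words-suc L A _) ⟩
        insertionTerm g (suc (suc L))
      ∎
      where
      open ≡-Reasoning
      start : ℤ → ℤ → ℕ
      start z a = sumℕ (words L A) (λ u → onSignedPerms (g ∘ (z ∷_)) (a ∷ u))
      firstLetter : ∀ a → ∣ a ∣ ≢ M → insertionTerm (afterFresh g a) (suc L) + (start z₁ a + start z₂ a) ≡
                    sumℕ (words L A) (λ u → ⟪ isSignedPerm (a ∷ u) ⟫ * insertEither g (a ∷ u))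
      firstLetter a ne = begin
          insertionTerm (afterFresh g a) (suc L) + (start z₁ a + start z₂ a)
        ≡⟨ cong (insertionTerm (afterFresh g a) (suc L) +_) (sym (ℕ-Sum.sum-distrib (words L A) _ _)) ⟩
          insertionTerm (afterFresh g a) (suc L)
            + sumℕ (words L A) (λ u → onSignedPerms (g ∘ (z₁ ∷_)) (a ∷ u) + onSignedPerms (g ∘ (z₂ ∷_)) (a ∷ u))
        ≡⟨ sym (ℕ-Sum.sum-distrib (words L A) _ _) ⟩
          sumℕ (words L A) (λ u → ⟪ isSignedPerm u ⟫ * insertEither (afterFresh g a) u
                                   + (onSignedPerms (g ∘ (z₁ ∷_)) (a ∷ u) + onSignedPerms (g ∘ (z₂ ∷_)) (a ∷ u)))
        ≡⟨ ℕ-Sum.sum-cong (words L A) (λ u → insertEither-∷ g a u ne) ⟩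
          sumℕ (words L A) (λ u → ⟪ isSignedPerm (a ∷ u) ⟫ * insertEither g (a ∷ u))
        ∎

  sum-words-extend : ∀ L g → sumℕ (words L B) (onSignedPerms g) ≡ sumℕ (words L A) (onSignedPerms g) + insertionTerm g L
  sum-words-extend zero    g = sym (NP.+-identityʳ _)
  sum-words-extend (suc L) g = begin
      sumℕ (words (suc L) B) (onSignedPerms g)
    ≡⟨ trans (sum-words-suc L B (onSignedPerms g)) (ℕ-Sum.sum-++ A (z₁ ∷ z₂ ∷ []) _) ⟩
      sumℕ A (λ a → sumℕ (words L B) (onSignedPerms g ∘ (a ∷_)))
        + sumℕ (z₁ ∷ z₂ ∷ []) (λ z → sumℕ (words L B) (onSignedPerms g ∘ (z ∷_)))
    ≡⟨ cong₂ _+_ (ℕ-Sum.sum-cong A (λ a → trans (ℕ-Sum.sum-cong (words L B) (onSignedPerms-∷ g a))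
                                                 (sum-words-extend L (afterFresh g a))))
                 (cong₂ _+_ (sum-startingWith g L z₁ h₁) (cong (_+ 0) (sum-startingWith g L z₂ h₂))) ⟩
      sumℕ A (λ a → sumℕ (words L A) (onSignedPerms (afterFresh g a)) + insertionTerm (afterFresh g a) L)
        + (startingWith g L z₁ + (startingWith g L z₂ + 0))
    ≡⟨ trans (cong (_+ (startingWith g L z₁ + (startingWith g L z₂ + 0)))
                   (ℕ-Sum.sum-distrib A (λ a → sumℕ (words L A) (onSignedPerms (afterFresh g a)))
                                        (λ a → insertionTerm (afterFresh g a) L)))
             (NP.+-assoc (sumℕ A (λ a → sumℕ (words L A) (onSignedPerms (afterFresh g a)))) _ _) ⟩
      sumℕ A (λ a → sumℕ (words L A) (onSignedPerms (afterFresh g a)))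
        + (sumℕ A (λ a → insertionTerm (afterFresh g a) L) + (startingWith g L z₁ + (startingWith g L z₂ + 0)))
    ≡⟨ cong₂ _+_ (sym (trans (sum-words-suc L A (onSignedPerms g))
                             (ℕ-Sum.sum-cong A (λ a → ℕ-Sum.sum-cong (words L A) (onSignedPerms-∷ g a)))))
                 (insertionTerm-suc L g) ⟩
      sumℕ (words (suc L) A) (onSignedPerms g) + insertionTerm g (suc L)
    ∎
    where open ≡-Reasoning

signedAlphabet-suc : ∀ k → signedAlphabet (suc k) ≡ signedAlphabet k ++ pos (suc k) ∷ Z.- pos (suc k) ∷ []
signedAlphabet-suc k = begin
    concatMap pair (applyUpTo suc (suc k))
  ≡⟨ cong (concatMap pair) (sym (LP.applyUpTo-∷ʳ suc k)) ⟩
    concatMap pair (applyUpTo suc k ++ suc k ∷ [])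
  ≡⟨ LP.concatMap-++ pair (applyUpTo suc k) (suc k ∷ []) ⟩
    signedAlphabet k ++ (pair (suc k) ++ [])
  ≡⟨ cong (signedAlphabet k ++_) (LP.++-identityʳ (pair (suc k))) ⟩
    signedAlphabet k ++ pos (suc k) ∷ Z.- pos (suc k) ∷ []
  ∎
  where
  open ≡-Reasoning
  pair : ℕ → List ℤ
  pair i = pos i ∷ Z.- pos i ∷ []

AbsIn : ℕ → ℤ → Set
AbsIn k b = (0 < ∣ b ∣) × (∣ b ∣ ≤ k)

all-AbsIn-signedAlphabet : ∀ k → All (AbsIn k) (signedAlphabet k)
all-AbsIn-signedAlphabet zero    = []
all-AbsIn-signedAlphabet (suc k) rewrite signedAlphabet-suc k =
  AllP.++⁺ (All.map (λ (p , q) → p , NP.m≤n⇒m≤1+n q) (all-AbsIn-signedAlphabet k))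
           ((s≤s z≤n , NP.≤-refl) ∷ (s≤s z≤n , NP.≤-refl) ∷ [])

all-≢-signedAlphabet : ∀ k → All (λ a → ∣ a ∣ ≢ suc k) (signedAlphabet k)
all-≢-signedAlphabet k = All.map (λ (_ , le) e → NP.<-irrefl refl (subst (_≤ k) e le)) (all-AbsIn-signedAlphabet k)

module ExtendSignedAlphabet (k : ℕ) =
  ExtendAlphabet (suc k) (signedAlphabet k) (pos (suc k)) (Z.- pos (suc k)) (all-≢-signedAlphabet k) refl refl

sum-words-signedAlphabet-suc : ∀ k L g →
  sumℕ (words L (signedAlphabet (suc k))) (onSignedPerms g)
    ≡ sumℕ (words L (signedAlphabet k)) (onSignedPerms g) + ExtendSignedAlphabet.insertionTerm k g L
sum-words-signedAlphabet-suc k L g =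
  trans (cong (λ X → sumℕ (words L X) (onSignedPerms g)) (signedAlphabet-suc k))
        (ExtendSignedAlphabet.sum-words-extend k L g)

sum-signedPerms-tooLong : ∀ k L (g : List ℤ → ℕ) → k < L → sumℕ (words L (signedAlphabet k)) (onSignedPerms g) ≡ 0
sum-signedPerms-tooLong zero    (suc L) g lt       = refl
sum-signedPerms-tooLong (suc k) (suc L) g (s≤s lt) =
  trans (sum-words-signedAlphabet-suc k (suc L) g)
        (cong₂ _+_ (sum-signedPerms-tooLong k (suc L) g (NP.m≤n⇒m≤1+n lt))
                   (sum-signedPerms-tooLong k L (ExtendSignedAlphabet.insertEither k g) lt))

descentsAllowed : List Bool → ℤ → List ℤ → Bool
descentsAllowed d       prev []      = true
descentsAllowed []      prev (b ∷ w) = true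
descentsAllowed (x ∷ d) prev (b ∷ w) = (if does (b Z.<? prev) then x else true) ∧ descentsAllowed d b w

countAllowed : ℕ → List Bool → ℕ
countAllowed m d = sumℕ (words m (signedAlphabet m)) (onSignedPerms (λ w → ⟪ descentsAllowed d (pos 0) w ⟫))

-- Inserting +M right after position i forces a descent at i + 1, inserting −M one at i; the comparison
-- between positions i and i + 1 of the shorter word disappears, so that word is unconstrained there.
slotSum : (List Bool → ℕ) → List Bool → ℕ
slotSum G []          = 0
slotSum G (x ∷ [])    = (1 + ⟪ x ⟫) * G []
slotSum G (x ∷ y ∷ r) = (⟪ y ⟫ + ⟪ x ⟫) * G (true ∷ r) + slotSum (G ∘ (x ∷_)) (y ∷ r)

slotSum-cong : ∀ d {G H : List Bool → ℕ} → (∀ e → G e ≡ H e) → slotSum G d ≡ slotSum H d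
slotSum-cong []          h = refl
slotSum-cong (x ∷ [])    h = cong ((1 + ⟪ x ⟫) *_) (h [])
slotSum-cong (x ∷ y ∷ r) h = cong₂ _+_ (cong ((⟪ y ⟫ + ⟪ x ⟫) *_) (h _)) (slotSum-cong (y ∷ r) (h ∘ (x ∷_)))

slotSum-*ˡ : ∀ d c (G : List Bool → ℕ) → slotSum (λ e → c * G e) d ≡ c * slotSum G d
slotSum-*ˡ []          c G = sym (NP.*-zeroʳ c)
slotSum-*ˡ (x ∷ [])    c G = lem (1 + ⟪ x ⟫) c (G [])
  where
  lem : ∀ a c g → a * (c * g) ≡ c * (a * g)
  lem = solve 3 (λ a c g → a :* (c :* g) := c :* (a :* g)) refl
slotSum-*ˡ (x ∷ y ∷ r) c G = trans (cong ((⟪ y ⟫ + ⟪ x ⟫) * (c * G (true ∷ r)) +_) (slotSum-*ˡ (y ∷ r) c (G ∘ (x ∷_))))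
                                   (lem (⟪ y ⟫ + ⟪ x ⟫) c (G (true ∷ r)) _)
  where
  lem : ∀ a c g s → a * (c * g) + c * s ≡ c * (a * g + s)
  lem = solve 4 (λ a c g s → a :* (c :* g) :+ c :* s := c :* (a :* g :+ s)) refl

slotSum-sum : {A : Set} (xs : List A) (F : A → List Bool → ℕ) (d : List Bool) →
              slotSum (λ e → sumℕ xs (λ u → F u e)) d ≡ sumℕ xs (λ u → slotSum (F u) d)
slotSum-sum xs F []          = sym (ℕ-Sum.sum-zero xs (λ _ → refl))
slotSum-sum xs F (x ∷ [])    = sym (sumℕ-*ˡ xs (1 + ⟪ x ⟫) (λ u → F u []))
slotSum-sum xs F (x ∷ y ∷ r) =
  trans (cong₂ _+_ (sym (sumℕ-*ˡ xs (⟪ y ⟫ + ⟪ x ⟫) (λ u → F u (true ∷ r))))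
                   (slotSum-sum xs (λ u e → F u (x ∷ e)) (y ∷ r)))
        (sym (ℕ-Sum.sum-distrib xs _ _))

AbsBelow : ℕ → ℤ → Set
AbsBelow M b = (Z.- pos M Z.< b) × (b Z.< pos M)

AbsIn⇒AbsBelow : ∀ m b → AbsIn m b → AbsBelow (suc m) b
AbsIn⇒AbsBelow m (pos (suc n)) (_ , le) = Z.-<+ , Z.+<+ (s≤s le)
AbsIn⇒AbsBelow m -[1+ n ]      (_ , le) = Z.-<- le , Z.-<+

module _ (M : ℕ) where
  private
    nM = Z.- pos M

  sumInsertions±-slotSum : ∀ u prev d → length d ≡ suc (length u) → AbsBelow M prev → All (AbsBelow M) u →
    sumInsertions (pos M) (λ v → ⟪ descentsAllowed d prev v ⟫) u + sumInsertions nM (λ v → ⟪ descentsAllowed d prev v ⟫) u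
      ≡ slotSum (λ e → ⟪ descentsAllowed e prev u ⟫) d
  sumInsertions±-slotSum [] prev (x ∷ []) ld (p₁ , p₂) []
    rewrite dec-false (pos M Z.<? prev) (ZP.<-asym p₂) | dec-true (nM Z.<? prev) p₁ with x
  ... | true  = refl
  ... | false = refl
  sumInsertions±-slotSum (b ∷ u) prev (x ∷ y ∷ r) ld (p₁ , p₂) ((q₁ , q₂) ∷ qs)
    rewrite dec-false (pos M Z.<? prev) (ZP.<-asym p₂) | dec-true (nM Z.<? prev) p₁
          | dec-true (b Z.<? pos M) q₂ | dec-false (b Z.<? nM) (ZP.<-asym q₁)
    = begin
        (⟪ y ∧ rest ⟫ + sumInsertions (pos M) (λ v → ⟪ c ∧ allowed v ⟫) u)
          + (⟪ x ∧ rest ⟫ + sumInsertions nM (λ v → ⟪ c ∧ allowed v ⟫) u)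
      ≡⟨ cong₂ (λ s t → (⟪ y ∧ rest ⟫ + s) + (⟪ x ∧ rest ⟫ + t)) (factor-c (pos M)) (factor-c nM) ⟩
        (⟪ y ∧ rest ⟫ + ⟪ c ⟫ * I₊) + (⟪ x ∧ rest ⟫ + ⟪ c ⟫ * I₋)
      ≡⟨ cong₂ (λ s t → (s + ⟪ c ⟫ * I₊) + (t + ⟪ c ⟫ * I₋)) (⟪∧⟫ y rest) (⟪∧⟫ x rest) ⟩
        (⟪ y ⟫ * ⟪ rest ⟫ + ⟪ c ⟫ * I₊) + (⟪ x ⟫ * ⟪ rest ⟫ + ⟪ c ⟫ * I₋)
      ≡⟨ ar ⟪ y ⟫ ⟪ x ⟫ ⟪ rest ⟫ ⟪ c ⟫ I₊ I₋ ⟩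
        (⟪ y ⟫ + ⟪ x ⟫) * ⟪ rest ⟫ + ⟪ c ⟫ * (I₊ + I₋)
      ≡⟨ cong₂ (λ s t → (⟪ y ⟫ + ⟪ x ⟫) * ⟪ s ∧ rest ⟫ + ⟪ c ⟫ * t) (sym (BP.if-eta (does (b Z.<? prev))))
                                                                    (sumInsertions±-slotSum u b (y ∷ r) (NP.suc-injective ld) (q₁ , q₂) qs) ⟩
        (⟪ y ⟫ + ⟪ x ⟫) * ⟪ (if does (b Z.<? prev) then true else true) ∧ rest ⟫
          + ⟪ c ⟫ * slotSum (λ e → ⟪ descentsAllowed e b u ⟫) (y ∷ r)
      ≡⟨ cong ((⟪ y ⟫ + ⟪ x ⟫) * ⟪ (if does (b Z.<? prev) then true else true) ∧ rest ⟫ +_)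
              (sym (trans (slotSum-cong (y ∷ r) (λ e → ⟪∧⟫ c (descentsAllowed e b u)))
                          (slotSum-*ˡ (y ∷ r) ⟪ c ⟫ (λ e → ⟪ descentsAllowed e b u ⟫)))) ⟩
        (⟪ y ⟫ + ⟪ x ⟫) * ⟪ (if does (b Z.<? prev) then true else true) ∧ rest ⟫
          + slotSum (λ e → ⟪ c ∧ descentsAllowed e b u ⟫) (y ∷ r)
      ∎
    where
    open ≡-Reasoning
    c    = if does (b Z.<? prev) then x else true
    rest = descentsAllowed r b u
    allowed : List ℤ → Bool
    allowed = descentsAllowed (y ∷ r) b
    I₊ = sumInsertions (pos M) (⟪_⟫ ∘ allowed) u
    I₋ = sumInsertions nM (⟪_⟫ ∘ allowed) u
    factor-c : ∀ z → sumInsertions z (λ v → ⟪ c ∧ allowed v ⟫) u ≡ ⟪ c ⟫ * sumInsertions z (⟪_⟫ ∘ allowed) u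
    factor-c z = trans (sumInsertions-cong z u (λ v → ⟪∧⟫ c (allowed v))) (sumInsertions-*ˡ z u ⟪ c ⟫ (⟪_⟫ ∘ allowed))
    ar : ∀ y x g c i₁ i₂ → (y * g + c * i₁) + (x * g + c * i₂) ≡ (y + x) * g + c * (i₁ + i₂)
    ar = solve 6 (λ y x g c i₁ i₂ → (y :* g :+ c :* i₁) :+ (x :* g :+ c :* i₂) := (y :+ x) :* g :+ c :* (i₁ :+ i₂)) refl

countAllowed-suc : ∀ m d → length d ≡ suc m → countAllowed (suc m) d ≡ slotSum (countAllowed m) d
countAllowed-suc m d ld = begin
    countAllowed (suc m) d
  ≡⟨ sum-words-signedAlphabet-suc m (suc m) g ⟩
    sumℕ (words (suc m) (signedAlphabet m)) (onSignedPerms g) + insertionTerm g (suc m)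
  ≡⟨ cong (_+ insertionTerm g (suc m)) (sum-signedPerms-tooLong m (suc m) g NP.≤-refl) ⟩
    sumℕ (words m (signedAlphabet m)) (λ u → ⟪ isSignedPerm u ⟫ * insertEither g u)
  ≡⟨ sum-words-cong m (signedAlphabet m) (All.map (AbsIn⇒AbsBelow m _) (all-AbsIn-signedAlphabet m))
       (λ w aw lw → cong (⟪ isSignedPerm w ⟫ *_)
          (sumInsertions±-slotSum (suc m) w (pos 0) d (trans ld (cong suc (sym lw))) (Z.-<+ , Z.+<+ (s≤s z≤n)) aw)) ⟩
    sumℕ (words m (signedAlphabet m)) (λ u → ⟪ isSignedPerm u ⟫ * slotSum (λ e → ⟪ descentsAllowed e (pos 0) u ⟫) d)
  ≡⟨ ℕ-Sum.sum-cong (words m (signedAlphabet m)) (λ u → sym (slotSum-*ˡ d ⟪ isSignedPerm u ⟫ _)) ⟩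
    sumℕ (words m (signedAlphabet m)) (λ u → slotSum (λ e → onSignedPerms (λ w → ⟪ descentsAllowed e (pos 0) w ⟫) u) d)
  ≡⟨ sym (slotSum-sum (words m (signedAlphabet m)) (λ u e → onSignedPerms (λ w → ⟪ descentsAllowed e (pos 0) w ⟫) u) d) ⟩
    slotSum (countAllowed m) d
  ∎
  where
  open ≡-Reasoning
  open ExtendSignedAlphabet m using (insertionTerm; insertEither)
  g : List ℤ → ℕ
  g w = ⟪ descentsAllowed d (pos 0) w ⟫

falses : ℕ → List Bool
falses n = replicate n false

-- A composition is a list of blocks of sizes c + 1; blockBits a cs marks the starts of those blocks
-- after a first run of a positions where no descent is allowed.
blocks : List ℕ → List Bool
blocks []       = []
blocks (c ∷ cs) = true ∷ falses c ++ blocks cs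

blockBits : ℕ → List ℕ → List Bool
blockBits a cs = falses a ++ blocks cs

totalSize : List ℕ → ℕ
totalSize []       = 0
totalSize (c ∷ cs) = suc c + totalSize cs

blockFactorials : List ℕ → ℕ
blockFactorials []       = 1
blockFactorials (c ∷ cs) = suc c ! * blockFactorials cs

shrinkFirst : ℕ → List ℕ → List ℕ
shrinkFirst zero    cs = cs
shrinkFirst (suc c) cs = c ∷ cs

sumShrinks : (List ℕ → ℕ) → List ℕ → ℕ
sumShrinks K []       = 0
sumShrinks K (c ∷ cs) = K (shrinkFirst c cs) + sumShrinks (K ∘ (c ∷_)) cs

shrinkHead : ℕ → (List Bool → ℕ) → List ℕ → ℕ
shrinkHead zero    G cs = 0
shrinkHead (suc a) G cs = G (blockBits a cs)

slotSum-falses++ : ∀ a cs (G : List Bool → ℕ) →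
  slotSum G (falses a ++ blocks cs) ≡ shrinkHead a G cs + slotSum (G ∘ (falses a ++_)) (blocks cs)
slotSum-falses++ zero          cs       G = refl
slotSum-falses++ (suc zero)    []       G = refl
slotSum-falses++ (suc zero)    (c ∷ cs) G = cong (_+ slotSum (G ∘ (false ∷_)) (blocks (c ∷ cs))) (NP.+-identityʳ _)
slotSum-falses++ (suc (suc a)) cs       G = slotSum-falses++ (suc a) cs (G ∘ (false ∷_))

slotSum-block : ∀ c cs (G : List Bool → ℕ) →
  slotSum G (blocks (c ∷ cs)) ≡ 2 * G (blocks (shrinkFirst c cs)) + slotSum (G ∘ (true ∷_) ∘ (falses c ++_)) (blocks cs)
slotSum-block zero    []       G = sym (NP.+-identityʳ _)
slotSum-block zero    (c ∷ cs) G = refl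
slotSum-block (suc c) cs       G =
  trans (cong (1 * G (blocks (c ∷ cs)) +_) (slotSum-falses++ (suc c) cs (G ∘ (true ∷_))))
        (lem (G (blocks (c ∷ cs))) _)
  where
  lem : ∀ x s → 1 * x + (x + s) ≡ 2 * x + s
  lem = solve 2 (λ x s → con 1 :* x :+ (x :+ s) := con 2 :* x :+ s) refl

slotSum-blocks : ∀ cs (G : List Bool → ℕ) → slotSum G (blocks cs) ≡ 2 * sumShrinks (G ∘ blocks) cs
slotSum-blocks []       G = refl
slotSum-blocks (c ∷ cs) G =
  trans (slotSum-block c cs G)
  (trans (cong (2 * G (blocks (shrinkFirst c cs)) +_) (slotSum-blocks cs (G ∘ (true ∷_) ∘ (falses c ++_))))
         (sym (NP.*-distribˡ-+ 2 (G (blocks (shrinkFirst c cs))) _)))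

slotSum-blockBits : ∀ a cs (G : List Bool → ℕ) →
  slotSum G (blockBits a cs) ≡ shrinkHead a G cs + 2 * sumShrinks (G ∘ blockBits a) cs
slotSum-blockBits a cs G = trans (slotSum-falses++ a cs G) (cong (shrinkHead a G cs +_) (slotSum-blocks cs (G ∘ (falses a ++_))))

length-blockBits : ∀ a cs → length (blockBits a cs) ≡ a + totalSize cs
length-blockBits a cs = trans (LP.length-++ (falses a)) (cong₂ _+_ (LP.length-replicate a) (length-blocks cs))
  where
  length-blocks : ∀ cs → length (blocks cs) ≡ totalSize cs
  length-blocks []       = refl
  length-blocks (c ∷ cs) = cong suc (trans (LP.length-++ (falses c)) (cong₂ _+_ (LP.length-replicate c) (length-blocks cs)))

-- Shrinking a block of size c + 1 divides blockFactorials by c + 1, and these sizes add up to totalSize.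
sumShrinks-blockFactorials : ∀ cs (K : List ℕ → ℕ) μ n C →
  (∀ cs' → totalSize cs' ≡ n → μ * (K cs' * blockFactorials cs') ≡ C) →
  totalSize cs ≡ suc n → μ * (sumShrinks K cs * blockFactorials cs) ≡ C * totalSize cs
sumShrinks-blockFactorials (c ∷ cs) K μ n C h e =
  trans (split μ (K (shrinkFirst c cs)) (sumShrinks (K ∘ (c ∷_)) cs) (suc c !) (blockFactorials cs))
        (trans (cong₂ _+_ (shrunk c size) (rest cs size)) (sym (NP.*-distribˡ-+ C (suc c) (totalSize cs))))
  where
  size : c + totalSize cs ≡ n
  size = NP.suc-injective e
  split : ∀ μ x y f p → μ * ((x + y) * (f * p)) ≡ μ * (x * (f * p)) + (μ * f) * (y * p)
  split = solve 5 (λ μ x y f p → μ :* ((x :+ y) :* (f :* p)) := μ :* (x :* (f :* p)) :+ (μ :* f) :* (y :* p)) refl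
  shrunk : ∀ c → c + totalSize cs ≡ n → μ * (K (shrinkFirst c cs) * (suc c ! * blockFactorials cs)) ≡ C * suc c
  shrunk zero    e₀ = trans (lem μ (K cs) (blockFactorials cs)) (trans (h cs e₀) (sym (NP.*-identityʳ C)))
    where
    lem : ∀ μ k p → μ * (k * ((1 + 0) * p)) ≡ μ * (k * p)
    lem = solve 3 (λ μ k p → μ :* (k :* ((con 1 :+ con 0) :* p)) := μ :* (k :* p)) refl
  shrunk (suc c) e₀ = trans (lem μ (K (c ∷ cs)) (suc (suc c)) (suc c !) (blockFactorials cs))
                            (trans (cong (suc (suc c) *_) (h (c ∷ cs) e₀)) (NP.*-comm (suc (suc c)) C))
    where
    lem : ∀ μ k s f p → μ * (k * ((s * f) * p)) ≡ s * (μ * (k * (f * p)))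
    lem = solve 5 (λ μ k s f p → μ :* (k :* ((s :* f) :* p)) := s :* (μ :* (k :* (f :* p)))) refl
  rest : ∀ ds → c + totalSize ds ≡ n →
         (μ * suc c !) * (sumShrinks (K ∘ (c ∷_)) ds * blockFactorials ds) ≡ C * totalSize ds
  rest []         e₀ = trans (NP.*-zeroʳ (μ * suc c !)) (sym (NP.*-zeroʳ C))
  rest (c₂ ∷ cs₂) e₀ =
    sumShrinks-blockFactorials (c₂ ∷ cs₂) (K ∘ (c ∷_)) (μ * suc c !) (c₂ + totalSize cs₂) C tail refl
    where
    lem : ∀ μ k f p → μ * (k * (f * p)) ≡ (μ * f) * (k * p)
    lem = solve 4 (λ μ k f p → μ :* (k :* (f :* p)) := (μ :* f) :* (k :* p)) refl
    tail : ∀ cs' → totalSize cs' ≡ c₂ + totalSize cs₂ → (μ * suc c !) * (K (c ∷ cs') * blockFactorials cs') ≡ C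
    tail cs' es = trans (sym (lem μ (K (c ∷ cs')) (suc c !) (blockFactorials cs')))
                        (h (c ∷ cs') (trans (cong (suc c +_) es) (trans (sym (NP.+-suc c (c₂ + totalSize cs₂))) e₀)))

countAllowed-blockBits-suc : ∀ m a cs → a + totalSize cs ≡ suc m →
  countAllowed (suc m) (blockBits a cs) ≡ shrinkHead a (countAllowed m) cs + 2 * sumShrinks (countAllowed m ∘ blockBits a) cs
countAllowed-blockBits-suc m a cs e =
  trans (countAllowed-suc m (blockBits a cs) (trans (length-blockBits a cs) e)) (slotSum-blockBits a cs (countAllowed m))

shrinks-countAllowed : ∀ m a c cs →
  (∀ a cs → a + totalSize cs ≡ m → countAllowed m (blockBits a cs) * (a ! * blockFactorials cs) ≡ m ! * 2 ^ totalSize cs) →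
  a + totalSize (c ∷ cs) ≡ suc m →
  a ! * (sumShrinks (countAllowed m ∘ blockBits a) (c ∷ cs) * blockFactorials (c ∷ cs))
    ≡ (m ! * 2 ^ (c + totalSize cs)) * totalSize (c ∷ cs)
shrinks-countAllowed m a c cs ih e =
  sumShrinks-blockFactorials (c ∷ cs) (countAllowed m ∘ blockBits a) (a !) (c + totalSize cs) (m ! * 2 ^ (c + totalSize cs)) h refl
  where
  a+n≡m : a + (c + totalSize cs) ≡ m
  a+n≡m = NP.suc-injective (trans (sym (NP.+-suc a (c + totalSize cs))) e)
  swap : ∀ f k p → f * (k * p) ≡ k * (f * p)
  swap = solve 3 (λ f k p → f :* (k :* p) := k :* (f :* p)) refl
  h : ∀ cs' → totalSize cs' ≡ c + totalSize cs → a ! * (countAllowed m (blockBits a cs') * blockFactorials cs') ≡ m ! * 2 ^ (c + totalSize cs)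
  h cs' es = trans (swap (a !) (countAllowed m (blockBits a cs')) (blockFactorials cs'))
                   (trans (ih a cs' (trans (cong (a +_) es) a+n≡m)) (cong (λ t → m ! * 2 ^ t) es))

-- Each block is increasing: m! / (a! ∏ (c + 1)!) chooses its letters, and 2 ^ totalSize the signs outside
-- the first run, which σ(0) = 0 forces to be positive.
countAllowed-blockBits : ∀ m a cs → a + totalSize cs ≡ m →
  countAllowed m (blockBits a cs) * (a ! * blockFactorials cs) ≡ m ! * 2 ^ totalSize cs
countAllowed-blockBits zero    zero    []       refl = refl
countAllowed-blockBits (suc m) (suc a) []       e    = begin
    countAllowed (suc m) (blockBits (suc a) []) * (suc a ! * 1)
  ≡⟨ cong (_* (suc a ! * 1)) (countAllowed-blockBits-suc m (suc a) [] e) ⟩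
    (countAllowed m (blockBits a []) + 2 * 0) * ((1 + a) * a ! * 1)
  ≡⟨ lem (countAllowed m (blockBits a [])) a (a !) ⟩
    suc a * (countAllowed m (blockBits a []) * (a ! * 1))
  ≡⟨ cong (suc a *_) (countAllowed-blockBits m a [] a+0≡m) ⟩
    suc a * (m ! * 1)
  ≡⟨ cong (λ t → suc t * (m ! * 1)) (trans (sym (NP.+-identityʳ a)) a+0≡m) ⟩
    suc m * (m ! * 1)
  ≡⟨ sym (NP.*-assoc (suc m) (m !) 1) ⟩
    suc m ! * 2 ^ totalSize []
  ∎
  where
  open ≡-Reasoning
  a+0≡m : a + 0 ≡ m
  a+0≡m = NP.suc-injective e
  lem : ∀ X a f → (X + 2 * 0) * ((1 + a) * f * 1) ≡ (1 + a) * (X * (f * 1))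
  lem = solve 3 (λ X a f → (X :+ con 2 :* con 0) :* ((con 1 :+ a) :* f :* con 1) := (con 1 :+ a) :* (X :* (f :* con 1))) refl
countAllowed-blockBits (suc m) zero    (c ∷ cs) e    = begin
    countAllowed (suc m) (blockBits 0 (c ∷ cs)) * (1 * blockFactorials (c ∷ cs))
  ≡⟨ cong (_* (1 * blockFactorials (c ∷ cs))) (countAllowed-blockBits-suc m 0 (c ∷ cs) e) ⟩
    (0 + 2 * S) * (1 * blockFactorials (c ∷ cs))
  ≡⟨ lem₁ S (blockFactorials (c ∷ cs)) ⟩
    2 * (1 * (S * blockFactorials (c ∷ cs)))
  ≡⟨ cong (2 *_) (shrinks-countAllowed m 0 c cs (countAllowed-blockBits m) e) ⟩
    2 * ((m ! * 2 ^ (c + totalSize cs)) * (1 + (c + totalSize cs)))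
  ≡⟨ lem₂ (c + totalSize cs) (m !) (2 ^ (c + totalSize cs)) ⟩
    ((1 + (c + totalSize cs)) * m !) * (2 * 2 ^ (c + totalSize cs))
  ≡⟨ cong (λ t → (t * m !) * (2 * 2 ^ (c + totalSize cs))) e ⟩
    suc m ! * 2 ^ totalSize (c ∷ cs)
  ∎
  where
  open ≡-Reasoning
  S = sumShrinks (countAllowed m ∘ blockBits 0) (c ∷ cs)
  lem₁ : ∀ S P → (0 + 2 * S) * (1 * P) ≡ 2 * (1 * (S * P))
  lem₁ = solve 2 (λ S P → (con 0 :+ con 2 :* S) :* (con 1 :* P) := con 2 :* (con 1 :* (S :* P))) refl
  lem₂ : ∀ n F T → 2 * ((F * T) * (1 + n)) ≡ ((1 + n) * F) * (2 * T)
  lem₂ = solve 3 (λ n F T → con 2 :* ((F :* T) :* (con 1 :+ n)) := ((con 1 :+ n) :* F) :* (con 2 :* T)) refl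
countAllowed-blockBits (suc m) (suc a) (c ∷ cs) e    = begin
    countAllowed (suc m) (blockBits (suc a) (c ∷ cs)) * (suc a ! * blockFactorials (c ∷ cs))
  ≡⟨ cong (_* (suc a ! * blockFactorials (c ∷ cs))) (countAllowed-blockBits-suc m (suc a) (c ∷ cs) e) ⟩
    (X + 2 * S) * ((suc a * a !) * blockFactorials (c ∷ cs))
  ≡⟨ lem₁ (suc a) (a !) X S (blockFactorials (c ∷ cs)) ⟩
    suc a * (X * (a ! * blockFactorials (c ∷ cs))) + 2 * ((suc a * a !) * (S * blockFactorials (c ∷ cs)))
  ≡⟨ cong₂ (λ s t → suc a * s + 2 * t) (countAllowed-blockBits m a (c ∷ cs) (NP.suc-injective e))
                                       (shrinks-countAllowed m (suc a) c cs (countAllowed-blockBits m) e) ⟩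
    suc a * (m ! * (2 * 2 ^ (c + totalSize cs))) + 2 * ((m ! * 2 ^ (c + totalSize cs)) * (1 + (c + totalSize cs)))
  ≡⟨ lem₂ a (c + totalSize cs) (m !) (2 ^ (c + totalSize cs)) ⟩
    ((1 + a) + (1 + (c + totalSize cs))) * m ! * (2 * 2 ^ (c + totalSize cs))
  ≡⟨ cong (λ t → t * m ! * (2 * 2 ^ (c + totalSize cs))) e ⟩
    suc m ! * 2 ^ totalSize (c ∷ cs)
  ∎
  where
  open ≡-Reasoning
  X = countAllowed m (blockBits a (c ∷ cs))
  S = sumShrinks (countAllowed m ∘ blockBits (suc a)) (c ∷ cs)
  lem₁ : ∀ sa f X S P → (X + 2 * S) * ((sa * f) * P) ≡ sa * (X * (f * P)) + 2 * ((sa * f) * (S * P))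
  lem₁ = solve 5 (λ sa f X S P → (X :+ con 2 :* S) :* ((sa :* f) :* P) := sa :* (X :* (f :* P)) :+ con 2 :* ((sa :* f) :* (S :* P))) refl
  lem₂ : ∀ a n F T → (1 + a) * (F * (2 * T)) + 2 * ((F * T) * (1 + n)) ≡ ((1 + a) + (1 + n)) * F * (2 * T)
  lem₂ = solve 4 (λ a n F T → (con 1 :+ a) :* (F :* (con 2 :* T)) :+ con 2 :* ((F :* T) :* (con 1 :+ n))
                              := ((con 1 :+ a) :+ (con 1 :+ n)) :* F :* (con 2 :* T)) refl

allMem : List ℕ → List ℕ → Bool
allMem S []       = true
allMem S (d ∷ ds) = memℕ d S ∧ allMem S ds

-- The helper of descIn is local to a where block of Defs; unification recovers it as allIn.
module _ (S : List ℕ) (w : List ℤ) where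
  mutual
    private
      allIn : List ℕ → Bool
      allIn = _

      allIn≡allMem : ∀ ds → allIn ds ≡ allMem S ds
      allIn≡allMem []       = refl
      allIn≡allMem (d ∷ ds) = cong (memℕ d S ∧_) (allIn≡allMem ds)

    descIn≡allMem : descIn S w ≡ allMem S (descentSet w)
    descIn≡allMem with descentSet w
    ... | ds = allIn≡allMem ds

memberBits : List ℕ → ℕ → ℕ → List Bool
memberBits S i zero    = []
memberBits S i (suc n) = memℕ i S ∷ memberBits S (suc i) n

allMem-descAux : ∀ S i prev w → allMem S (descAux i (prev ∷ w)) ≡ descentsAllowed (memberBits S i (length w)) prev w
allMem-descAux S i prev []      = refl
allMem-descAux S i prev (b ∷ w) with does (b Z.<? prev)
... | true  = cong (memℕ i S ∧_) (allMem-descAux S (suc i) b w)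
... | false = allMem-descAux S (suc i) b w

alphaPlus≡countAllowed : ∀ m S → memℕ 0 S ≡ false → alphaPlus (suc m) S ≡ countAllowed (suc m) (memberBits S 0 (suc m))
alphaPlus≡countAllowed m S 0∉S = begin
    alphaPlus (suc m) S
  ≡⟨ length-filter (descIn S) (Bplus (suc m)) ⟩
    sumℕ (Bplus (suc m)) (⟪_⟫ ∘ descIn S)
  ≡⟨ sumℕ-filter (λ w → isSignedPerm w ∧ firstPositive w) (words (suc m) (signedAlphabet (suc m))) (⟪_⟫ ∘ descIn S) ⟩
    sumℕ (words (suc m) (signedAlphabet (suc m))) (λ w → ⟪ isSignedPerm w ∧ firstPositive w ⟫ * ⟪ descIn S w ⟫)
  ≡⟨ sum-words-cong (suc m) (signedAlphabet (suc m)) (all-AbsIn-signedAlphabet (suc m)) word ⟩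
    countAllowed (suc m) (memberBits S 0 (suc m))
  ∎
  where
  open ≡-Reasoning
  allowed : List ℤ → Bool
  allowed = descentsAllowed (memberBits S 0 (suc m)) (pos 0)
  -- 0 ∉ S forbids a descent at position 0, which is exactly σ(1) > 0.
  word : ∀ w → All (AbsIn (suc m)) w → length w ≡ suc m →
         ⟪ isSignedPerm w ∧ firstPositive w ⟫ * ⟪ descIn S w ⟫ ≡ ⟪ isSignedPerm w ⟫ * ⟪ allowed w ⟫
  word (b ∷ w) (b∈ ∷ _) lw =
    trans (cong (λ t → ⟪ isSignedPerm (b ∷ w) ∧ firstPositive (b ∷ w) ⟫ * ⟪ t ⟫)
                (trans (descIn≡allMem S (b ∷ w))
                (trans (allMem-descAux S 0 (pos 0) (b ∷ w))
                       (cong (λ k → descentsAllowed (memberBits S 0 k) (pos 0) (b ∷ w)) lw))))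
          (first b b∈)
    where
    first : ∀ b → AbsIn (suc m) b →
            ⟪ isSignedPerm (b ∷ w) ∧ firstPositive (b ∷ w) ⟫ * ⟪ allowed (b ∷ w) ⟫ ≡ ⟪ isSignedPerm (b ∷ w) ⟫ * ⟪ allowed (b ∷ w) ⟫
    first (pos (suc n)) _ = cong (λ t → ⟪ t ⟫ * ⟪ allowed (pos (suc n) ∷ w) ⟫) (BP.∧-identityʳ (isSignedPerm (pos (suc n) ∷ w)))
    first -[1+ n ]      _ rewrite 0∉S | BP.∧-zeroʳ (isSignedPerm (-[1+ n ] ∷ w)) = sym (NP.*-zeroʳ ⟪ isSignedPerm (-[1+ n ] ∷ w) ⟫)

Chain : ℕ → List ℕ → ℕ → Set
Chain lo []       hi = lo < hi
Chain lo (x ∷ xs) hi = (lo < x) × Chain x xs hi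

Chain⇒< : ∀ lo xs hi → Chain lo xs hi → lo < hi
Chain⇒< lo []       hi c       = c
Chain⇒< lo (x ∷ xs) hi (l , c) = NP.<-trans l (Chain⇒< x xs hi c)

Chain⇒All< : ∀ lo xs hi → Chain lo xs hi → All (lo <_) xs
Chain⇒All< lo []       hi c       = []
Chain⇒All< lo (x ∷ xs) hi (l , c) = l ∷ All.map (NP.<-trans l) (Chain⇒All< x xs hi c)

∸≡suc[∸suc] : ∀ {s m} → s < m → m ∸ s ≡ suc (m ∸ suc s)
∸≡suc[∸suc] (s≤s s≤m) = NP.+-∸-assoc 1 s≤m

[t∸s]+[m∸t]≡m∸s : ∀ s t m → s ≤ t → t ≤ m → (t ∸ s) + (m ∸ t) ≡ m ∸ s
[t∸s]+[m∸t]≡m∸s zero    t       m       _       t≤m     = NP.m+[n∸m]≡n t≤m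
[t∸s]+[m∸t]≡m∸s (suc s) (suc t) (suc m) (s≤s a) (s≤s b) = [t∸s]+[m∸t]≡m∸s s t m a b

memberBits-cong : ∀ S S' i n → (∀ j → i ≤ j → j < n + i → memℕ j S ≡ memℕ j S') → memberBits S i n ≡ memberBits S' i n
memberBits-cong S S' i zero    h = refl
memberBits-cong S S' i (suc n) h =
  cong₂ _∷_ (h i NP.≤-refl (s≤s (NP.m≤n+m i n)))
            (memberBits-cong S S' (suc i) n (λ j ij jn → h j (NP.<⇒≤ ij) (subst (j <_) (NP.+-suc n i) jn)))

memberBits-[] : ∀ i n → memberBits [] i n ≡ falses n
memberBits-[] i zero    = refl
memberBits-[] i (suc n) = cong (false ∷_) (memberBits-[] (suc i) n)

memberBits-+ : ∀ S i p n → memberBits S i (p + n) ≡ memberBits S i p ++ memberBits S (p + i) n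
memberBits-+ S i zero    n = refl
memberBits-+ S i (suc p) n =
  cong (memℕ i S ∷_) (trans (memberBits-+ S (suc i) p n) (cong (λ k → memberBits S (suc i) p ++ memberBits S k n) (NP.+-suc p i)))

firstOr : List ℕ → ℕ → ℕ
firstOr []      m = m
firstOr (s ∷ _) m = s

firstOr≤ : ∀ S m → Chain 0 S m → firstOr S m ≤ m
firstOr≤ []       m c       = NP.≤-refl
firstOr≤ (s ∷ ss) m (_ , c) = NP.<⇒≤ (Chain⇒< s ss m c)

-- gapsFrom s ts hi: the blocks s+1..t₁, t₁+1..t₂, …, t_k+1..hi, each recorded as its size minus one.
gapsFrom : ℕ → List ℕ → ℕ → List ℕ
gapsFrom s []       hi = (hi ∸ suc s) ∷ []
gapsFrom s (t ∷ ts) hi = (t ∸ suc s) ∷ gapsFrom t ts hi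

gaps : List ℕ → ℕ → List ℕ
gaps []       m = []
gaps (s ∷ ss) m = gapsFrom s ss m

mutual
  memberBits-gapsFrom : ∀ s ts hi → Chain s ts hi → true ∷ memberBits ts (suc s) (hi ∸ suc s) ≡ blocks (gapsFrom s ts hi)
  memberBits-gapsFrom s []       hi c        =
    cong (true ∷_) (trans (memberBits-[] (suc s) (hi ∸ suc s)) (sym (LP.++-identityʳ _)))
  memberBits-gapsFrom s (t ∷ ts) hi (s<t , c) = cong (true ∷_) (memberBits-from s<t c)

  memberBits-from : ∀ {i t ts hi} → i ≤ t → Chain t ts hi →
                    memberBits (t ∷ ts) i (hi ∸ i) ≡ falses (t ∸ i) ++ blocks (gapsFrom t ts hi)
  memberBits-from {i} {t} {ts} {hi} i≤t c = begin
      memberBits (t ∷ ts) i (hi ∸ i)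
    ≡⟨ cong (memberBits (t ∷ ts) i) (sym ([t∸s]+[m∸t]≡m∸s i t hi i≤t (NP.<⇒≤ t<hi))) ⟩
      memberBits (t ∷ ts) i ((t ∸ i) + (hi ∸ t))
    ≡⟨ memberBits-+ (t ∷ ts) i (t ∸ i) (hi ∸ t) ⟩
      memberBits (t ∷ ts) i (t ∸ i) ++ memberBits (t ∷ ts) ((t ∸ i) + i) (hi ∸ t)
    ≡⟨ cong₂ _++_ (trans (memberBits-cong (t ∷ ts) [] i (t ∸ i) below) (memberBits-[] i (t ∸ i)))
                  (cong (λ k → memberBits (t ∷ ts) k (hi ∸ t)) (NP.m∸n+n≡m i≤t)) ⟩
      falses (t ∸ i) ++ memberBits (t ∷ ts) t (hi ∸ t)
    ≡⟨ cong (λ k → falses (t ∸ i) ++ memberBits (t ∷ ts) t k) (∸≡suc[∸suc] t<hi) ⟩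
      falses (t ∸ i) ++ (memℕ t (t ∷ ts) ∷ memberBits (t ∷ ts) (suc t) (hi ∸ suc t))
    ≡⟨ cong₂ (λ x y → falses (t ∸ i) ++ (x ∷ y)) (cong (_∨ memℕ t ts) (≡ᵇ-refl t))
                                                 (memberBits-cong (t ∷ ts) ts (suc t) (hi ∸ suc t) above) ⟩
      falses (t ∸ i) ++ (true ∷ memberBits ts (suc t) (hi ∸ suc t))
    ≡⟨ cong (falses (t ∸ i) ++_) (memberBits-gapsFrom t ts hi c) ⟩
      falses (t ∸ i) ++ blocks (gapsFrom t ts hi)
    ∎
    where
    open ≡-Reasoning
    t<hi : t < hi
    t<hi = Chain⇒< t ts hi c
    below : ∀ j → i ≤ j → j < (t ∸ i) + i → memℕ j (t ∷ ts) ≡ memℕ j []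
    below j _ j< = memℕ-false j (t ∷ ts) (j<t ∷ All.map (NP.<-trans j<t) (Chain⇒All< t ts hi c))
      where
      j<t : j < t
      j<t = subst (j <_) (NP.m∸n+n≡m i≤t) j<
    above : ∀ j → suc t ≤ j → j < (hi ∸ suc t) + suc t → memℕ j (t ∷ ts) ≡ memℕ j ts
    above j t<j _ = cong (_∨ memℕ j ts) (≢⇒≡ᵇ-false j t (λ e → NP.<-irrefl (sym e) t<j))

memberBits≡blockBits : ∀ S m → Chain 0 S m → memberBits S 0 m ≡ blockBits (firstOr S m) (gaps S m)
memberBits≡blockBits []       m c       = trans (memberBits-[] 0 m) (sym (LP.++-identityʳ _))
memberBits≡blockBits (s ∷ ss) m (_ , c) = memberBits-from z≤n c

prodFact-co : ∀ S m → Chain 0 S m → prodFact (co m S) ≡ firstOr S m ! * blockFactorials (gaps S m)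
prodFact-co []       m c       = refl
prodFact-co (s ∷ ss) m (_ , c) = cong (s ! *_) (prodFact-coAux s ss m c)
  where
  prodFact-coAux : ∀ s ss m → Chain s ss m → prodFact (coAux m s ss) ≡ blockFactorials (gapsFrom s ss m)
  prodFact-coAux s []       m c         = cong (λ x → x ! * 1) (∸≡suc[∸suc] c)
  prodFact-coAux s (t ∷ ts) m (s<t , c) = cong₂ (λ x y → x ! * y) (∸≡suc[∸suc] s<t) (prodFact-coAux t ts m c)

totalSize-gaps : ∀ S m → Chain 0 S m → totalSize (gaps S m) ≡ m ∸ firstOr S m
totalSize-gaps []       m c       = sym (NP.n∸n≡0 m)
totalSize-gaps (s ∷ ss) m (_ , c) = totalSize-gapsFrom s ss m c
  where
  totalSize-gapsFrom : ∀ s ss m → Chain s ss m → totalSize (gapsFrom s ss m) ≡ m ∸ s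
  totalSize-gapsFrom s []       m c         = trans (NP.+-identityʳ _) (sym (∸≡suc[∸suc] c))
  totalSize-gapsFrom s (t ∷ ts) m (s<t , c) =
    trans (cong₂ _+_ (sym (∸≡suc[∸suc] s<t)) (totalSize-gapsFrom t ts m c))
          ([t∸s]+[m∸t]≡m∸s s t m (NP.<⇒≤ s<t) (NP.<⇒≤ (Chain⇒< t ts m c)))

alphaPlus-formula : ∀ m S → Chain 0 S m → alphaPlus m S * prodFact (co m S) ≡ m ! * 2 ^ (m ∸ firstOr S m)
alphaPlus-formula zero    S c = ⊥-elim (NP.<-irrefl refl (Chain⇒< 0 S 0 c))
alphaPlus-formula (suc m) S c = begin
    alphaPlus (suc m) S * prodFact (co (suc m) S)
  ≡⟨ cong₂ _*_ (trans (alphaPlus≡countAllowed m S (memℕ-false 0 S (Chain⇒All< 0 S (suc m) c)))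
                      (cong (countAllowed (suc m)) (memberBits≡blockBits S (suc m) c)))
               (prodFact-co S (suc m) c) ⟩
    countAllowed (suc m) (blockBits s₁ (gaps S (suc m))) * (s₁ ! * blockFactorials (gaps S (suc m)))
  ≡⟨ countAllowed-blockBits (suc m) s₁ (gaps S (suc m))
       (trans (cong (s₁ +_) (totalSize-gaps S (suc m) c)) (NP.m+[n∸m]≡n (firstOr≤ S (suc m) c))) ⟩
    suc m ! * 2 ^ totalSize (gaps S (suc m))
  ≡⟨ cong (λ k → suc m ! * 2 ^ k) (totalSize-gaps S (suc m) c) ⟩
    suc m ! * 2 ^ (suc m ∸ s₁)
  ∎
  where
  open ≡-Reasoning
  s₁ = firstOr S (suc m)

/-≡-cross : ∀ a b c d .{{_ : NonZero b}} .{{_ : NonZero d}} → a * d ≡ c * b → pos a Q./ b ≡ pos c Q./ d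
/-≡-cross a (suc b) c (suc d) e =
  QP.fromℚᵘ-cong {U.mkℚᵘ (pos a) b} {U.mkℚᵘ (pos c) d}
    (U.*≡* (trans (sym (ZP.pos-* a (suc d))) (trans (cong pos e) (ZP.pos-* c (suc b)))))

/-*-/ : ∀ a b c d .{{_ : NonZero b}} .{{_ : NonZero d}} →
         (pos a Q./ b) *q (pos c Q./ d) ≡ (pos (a * c) Q./ (b * d)) {{NP.m*n≢0 b d}}
/-*-/ a (suc b) c (suc d) =
  QP.toℚᵘ-injective {(pos a Q./ suc b) *q (pos c Q./ suc d)} {pos (a * c) Q./ (suc b * suc d)}
  (UP.≃-trans (QP.toℚᵘ-homo-* (pos a Q./ suc b) (pos c Q./ suc d))
  (UP.≃-trans (UP.*-cong (QP.toℚᵘ-fromℚᵘ (pos a U./ suc b)) (QP.toℚᵘ-fromℚᵘ (pos c U./ suc d)))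
  (UP.≃-trans (U.*≡* {(pos a Z.* pos c) U./ (suc b * suc d)} {pos (a * c) U./ (suc b * suc d)}
                     (cong (Z._* pos (suc b * suc d)) (sym (ZP.pos-* a c))))
              (UP.≃-sym (QP.toℚᵘ-fromℚᵘ (pos (a * c) U./ (suc b * suc d)))))))

expTerm : ℕ → Q.ℚ
expTerm e = (2 ^ e) over! e

coshTerm : ℕ → Q.ℚ
coshTerm e = if isEvenPos e then expTerm e else 0q

denom-1 : ∀ e → denom 1 e ≡ -q coshTerm e
denom-1 e with isEvenPos e
... | true  = refl
... | false = refl

sum-*denom-0 : ∀ m (F : ℕ → Q.ℚ) → sumℚ (upTo (suc m)) (λ j → F j *q denom 0 (m ∸ j)) ≡ F m
sum-*denom-0 m F = begin
    sumℚ (upTo (suc m)) (λ j → F j *q denom 0 (m ∸ j))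
  ≡⟨ ℚ-Sum.sum-upTo-suc m _ ⟩
    sumℚ (upTo m) (λ j → F j *q denom 0 (m ∸ j)) +q F m *q denom 0 (m ∸ m)
  ≡⟨ cong₂ _+q_ (ℚ-Sum.sum-upTo-zero m (λ j j<m → trans (cong (λ e → F j *q denom 0 e) (∸≡suc[∸suc] j<m)) (QP.*-zeroʳ (F j))))
                (trans (cong (λ e → F m *q denom 0 e) (NP.n∸n≡0 m)) (QP.*-identityʳ (F m))) ⟩
    0q +q F m
  ≡⟨ QP.+-identityˡ (F m) ⟩
    F m
  ∎
  where open ≡-Reasoning

⋆denom-solution : (L T : Series) → (∀ m → L 0 m ≡ T 0 m) → (∀ k m → T (suc k) m ≡ 0q) →
                  (∀ j m → L (suc j) m ≡ sumℚ (upTo (suc m)) (λ t → L j t *q coshTerm (m ∸ t))) →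
                  ∀ k m → (L ⋆ denom) k m ≡ T k m
⋆denom-solution L T h0 hT hrec zero    m = trans (QP.+-identityʳ _) (trans (sum-*denom-0 m (L 0)) (h0 m))
⋆denom-solution L T h0 hT hrec (suc k) m = begin
    sumℚ (upTo (suc (suc k))) (λ i → column i (suc k ∸ i))
  ≡⟨ trans (ℚ-Sum.sum-upTo-suc (suc k) (λ i → column i (suc k ∸ i)))
             (cong (_+q column (suc k) (k ∸ k)) (ℚ-Sum.sum-upTo-suc k (λ i → column i (suc k ∸ i)))) ⟩
    (sumℚ (upTo k) (λ i → column i (suc k ∸ i)) +q column k (suc k ∸ k)) +q column (suc k) (k ∸ k)
  ≡⟨ cong₂ (λ a b → (a +q b) +q column (suc k) (k ∸ k)) (ℚ-Sum.sum-upTo-zero k high) (cong (column k) (NP.m+n∸n≡m 1 k)) ⟩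
    (0q +q column k 1) +q column (suc k) (k ∸ k)
  ≡⟨ cong₂ (λ a b → (0q +q a) +q b) column-1 (trans (cong (column (suc k)) (NP.n∸n≡0 k)) (sum-*denom-0 m (L (suc k)))) ⟩
    (0q +q -q X) +q L (suc k) m
  ≡⟨ cong ((0q +q -q X) +q_) (hrec k m) ⟩
    (0q +q -q X) +q X
  ≡⟨ trans (cong (_+q X) (QP.+-identityˡ (-q X))) (QP.+-inverseˡ X) ⟩
    0q
  ≡⟨ sym (hT k m) ⟩
    T (suc k) m
  ∎
  where
  open ≡-Reasoning
  column : ℕ → ℕ → Q.ℚ
  column i c = sumℚ (upTo (suc m)) (λ j → L i j *q denom c (m ∸ j))
  X : Q.ℚ
  X = sumℚ (upTo (suc m)) (λ j → L k j *q coshTerm (m ∸ j))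
  high : ∀ i → i < k → column i (suc k ∸ i) ≡ 0q
  high i i<k = trans (cong (column i) (trans (∸≡suc[∸suc] (NP.m≤n⇒m≤1+n i<k)) (cong suc (∸≡suc[∸suc] i<k))))
                     (ℚ-Sum.sum-zero (upTo (suc m)) (λ j → QP.*-zeroʳ (L i j)))
  column-1 : column k 1 ≡ -q X
  column-1 = begin
      column k 1
    ≡⟨ ℚ-Sum.sum-cong (upTo (suc m)) (λ j → trans (cong (L k j *q_) (denom-1 (m ∸ j))) (sym (QP.neg-distribʳ-* (L k j) _))) ⟩
      sumℚ (upTo (suc m)) (λ j → -q (L k j *q coshTerm (m ∸ j)))
    ≡⟨ sym (ℚ-Sum.sum-homo -q_ refl QP.neg-distrib-+ (upTo (suc m)) (λ j → L k j *q coshTerm (m ∸ j))) ⟩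
      -q X
    ∎

isOdd-2* : ∀ k → isOdd (2 * k) ≡ false
isOdd-2* zero    = refl
isOdd-2* (suc k) = trans (cong isOdd (NP.*-suc 2 k)) (isOdd-2* k)

isOdd-1+2* : ∀ k → isOdd (suc (2 * k)) ≡ true
isOdd-1+2* zero    = refl
isOdd-1+2* (suc k) = trans (cong (isOdd ∘ suc) (NP.*-suc 2 k)) (isOdd-1+2* k)

half : ℕ → ℕ
half zero          = zero
half (suc zero)    = zero
half (suc (suc m)) = suc (half m)

half-1+2* : ∀ k → half (suc (2 * k)) ≡ k
half-1+2* zero    = refl
half-1+2* (suc k) = trans (cong (half ∘ suc) (NP.*-suc 2 k)) (cong suc (half-1+2* k))

isEvenPos-1+2* : ∀ d → isEvenPos (suc (2 * d)) ≡ false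
isEvenPos-1+2* zero    = refl
isEvenPos-1+2* (suc d) = trans (cong (isEvenPos ∘ suc) (NP.*-suc 2 d)) (cong not (isOdd-1+2* d))

isEvenPos-2*∸2* : ∀ i k → i < k → isEvenPos (2 * k ∸ 2 * i) ≡ true
isEvenPos-2*∸2* zero    (suc k) _         = trans (cong isEvenPos (NP.*-suc 2 k)) (cong not (isOdd-2* k))
isEvenPos-2*∸2* (suc i) (suc k) (s≤s i<k) =
  trans (cong₂ (λ a b → isEvenPos (a ∸ b)) (NP.*-suc 2 k) (NP.*-suc 2 i)) (isEvenPos-2*∸2* i k i<k)

isEvenPos-2*∸1+2* : ∀ i k → i < k → isEvenPos (2 * k ∸ suc (2 * i)) ≡ false
isEvenPos-2*∸1+2* zero    (suc k) _         = trans (cong (λ n → isEvenPos (n ∸ 1)) (NP.*-suc 2 k)) (isEvenPos-1+2* k)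
isEvenPos-2*∸1+2* (suc i) (suc k) (s≤s i<k) =
  trans (cong₂ (λ a b → isEvenPos (a ∸ suc b)) (NP.*-suc 2 k) (NP.*-suc 2 i)) (isEvenPos-2*∸1+2* i k i<k)

even⊎odd : ∀ m → Σ ℕ (λ k → m ≡ 2 * k) ⊎ Σ ℕ (λ k → m ≡ suc (2 * k))
even⊎odd zero = inj₁ (0 , refl)
even⊎odd (suc m) with even⊎odd m
... | inj₁ (k , e) = inj₂ (k , cong suc e)
... | inj₂ (k , e) = inj₁ (suc k , trans (cong suc e) (sym (NP.*-suc 2 k)))

oddSeq-isOdd : ∀ (g F : ℕ → Q.ℚ) → (∀ k → g (suc k) ≡ F (suc (2 * k))) →
               ∀ m → oddSeq g m ≡ (if isOdd m then F m else 0q)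
oddSeq-isOdd g F h zero          = refl
oddSeq-isOdd g F h (suc zero)    = h 0
oddSeq-isOdd g F h (suc (suc m)) =
  oddSeq-isOdd (g ∘ suc) (F ∘ suc ∘ suc) (λ k → trans (h (suc k)) (cong (F ∘ suc) (NP.*-suc 2 k))) m

odds : ℕ → List ℕ
odds k = applyUpTo (λ i → suc (2 * i)) k

Chain-∷ʳ : ∀ lo xs x hi → Chain lo xs x → x < hi → Chain lo (xs ++ x ∷ []) hi
Chain-∷ʳ lo []       x hi c        x<hi = c , x<hi
Chain-∷ʳ lo (y ∷ ys) x hi (lo<y , c) x<hi = lo<y , Chain-∷ʳ y ys x hi c x<hi

Chain-odds : ∀ k → Chain 0 (odds k) (suc (2 * k))
Chain-odds zero    = s≤s z≤n
Chain-odds (suc k) = subst (λ l → Chain 0 l (suc (2 * suc k))) (LP.applyUpTo-∷ʳ (λ i → suc (2 * i)) k)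
  (Chain-∷ʳ 0 (odds k) (suc (2 * k)) (suc (2 * suc k)) (Chain-odds k)
     (subst (suc (2 * k) <_) (cong suc (sym (NP.*-suc 2 k))) (NP.<-trans (NP.n<1+n _) (NP.n<1+n _))))

Chain-sublists : ∀ lo xs hi → Chain lo xs hi → All (λ S → Chain lo S hi) (sublists xs)
Chain-sublists lo []       hi c          = c ∷ []
Chain-sublists lo (a ∷ as) hi (lo<a , c) =
  AllP.++⁺ (All.map (weaken _) (Chain-sublists a as hi c)) (AllP.map⁺ (All.map (lo<a ,_) (Chain-sublists a as hi c)))
  where
  weaken : ∀ S → Chain a S hi → Chain lo S hi
  weaken []       c'         = NP.<-trans lo<a c'
  weaken (s ∷ ss) (a<s , c') = NP.<-trans lo<a a<s , c'

length-∷ʳ : ∀ (S : List ℕ) x → length (S ++ x ∷ []) ≡ suc (length S)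
length-∷ʳ []      x = refl
length-∷ʳ (s ∷ S) x = cong suc (length-∷ʳ S x)

prodFact-co-∷ʳ : ∀ m S s → prodFact (co m (S ++ s ∷ [])) ≡ prodFact (co s S) * ((m ∸ s) ! * 1)
prodFact-co-∷ʳ m S s = trans (cong prodFact (coAux-∷ʳ 0 S)) (prodFact-++ (co s S) ((m ∸ s) ∷ []))
  where
  coAux-∷ʳ : ∀ prev S → coAux m prev (S ++ s ∷ []) ≡ coAux s prev S ++ (m ∸ s) ∷ []
  coAux-∷ʳ prev []      = refl
  coAux-∷ʳ prev (x ∷ S) = cong ((x ∸ prev) ∷_) (coAux-∷ʳ x S)
  prodFact-++ : ∀ xs ys → prodFact (xs ++ ys) ≡ prodFact xs * prodFact ys
  prodFact-++ []       ys = sym (NP.+-identityʳ (prodFact ys))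
  prodFact-++ (x ∷ xs) ys = trans (cong (x ! *_) (prodFact-++ xs ys)) (sym (NP.*-assoc (x !) _ _))

-- An odd m contributes Σ_{S ⊆ odds below m, |S| = j} term m S to the coefficient of x^j t^m.
module OddSubsetSeries (base : List ℕ → ℕ → ℕ) (base-∷ʳ : ∀ S s m → base (S ++ s ∷ []) m ≡ base S s)
                       (base≤ : ∀ S s → Chain 0 S s → base S s ≤ s) where

  term : ℕ → List ℕ → Q.ℚ
  term m S = (pos (2 ^ (m ∸ base S m)) Q./ prodFact (co m S)) {{prodFact≢0 (co m S)}}

  term-∷ʳ : ∀ S s m → Chain 0 S s → s ≤ m → term m (S ++ s ∷ []) ≡ term s S *q expTerm (m ∸ s)
  term-∷ʳ S s m c s≤m = sym (begin
      term s S *q expTerm (m ∸ s)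
    ≡⟨ /-*-/ (2 ^ (s ∸ b)) P (2 ^ (m ∸ s)) ((m ∸ s) !) {{prodFact≢0 (co s S)}} {{(m ∸ s) !≢0}} ⟩
      (pos (2 ^ (s ∸ b) * 2 ^ (m ∸ s)) Q./ (P * (m ∸ s) !)) {{NP.m*n≢0 P _ {{prodFact≢0 (co s S)}} {{(m ∸ s) !≢0}}}}
    ≡⟨ /-≡-cross (2 ^ (s ∸ b) * 2 ^ (m ∸ s)) (P * (m ∸ s) !) (2 ^ (m ∸ base (S ++ s ∷ []) m)) (prodFact (co m (S ++ s ∷ [])))
                  {{NP.m*n≢0 P _ {{prodFact≢0 (co s S)}} {{(m ∸ s) !≢0}}}} {{prodFact≢0 (co m (S ++ s ∷ []))}} cross ⟩
      term m (S ++ s ∷ [])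
    ∎)
    where
    open ≡-Reasoning
    b = base S s
    P = prodFact (co s S)
    pow : 2 ^ (m ∸ base (S ++ s ∷ []) m) ≡ 2 ^ (s ∸ b) * 2 ^ (m ∸ s)
    pow = trans (cong (λ h → 2 ^ (m ∸ h)) (base-∷ʳ S s m))
                (trans (cong (2 ^_) (sym ([t∸s]+[m∸t]≡m∸s b s m (base≤ S s c) s≤m))) (NP.^-distribˡ-+-* 2 (s ∸ b) (m ∸ s)))
    lem : ∀ X Y P E → (X * Y) * (P * (E * 1)) ≡ (X * Y) * (P * E)
    lem = solve 4 (λ X Y P E → (X :* Y) :* (P :* (E :* con 1)) := (X :* Y) :* (P :* E)) refl
    cross : (2 ^ (s ∸ b) * 2 ^ (m ∸ s)) * prodFact (co m (S ++ s ∷ [])) ≡ 2 ^ (m ∸ base (S ++ s ∷ []) m) * (P * (m ∸ s) !)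
    cross = trans (cong ((2 ^ (s ∸ b) * 2 ^ (m ∸ s)) *_) (prodFact-co-∷ʳ m S s))
                  (trans (lem (2 ^ (s ∸ b)) (2 ^ (m ∸ s)) P ((m ∸ s) !)) (cong (_* (P * (m ∸ s) !)) (sym pow)))

  subsetSum : ℕ → ℕ → ℕ → Q.ℚ
  subsetSum j k m = sumℚ (sublists (odds k)) (λ S → if length S ≡ᵇ j then term m S else 0q)

  subsetSum-suc : ∀ j k m → subsetSum j (suc k) m ≡ subsetSum j k m +q
    sumℚ (sublists (odds k)) (λ S → if length (S ++ suc (2 * k) ∷ []) ≡ᵇ j then term m (S ++ suc (2 * k) ∷ []) else 0q)
  subsetSum-suc j k m =
    trans (cong (λ l → sumℚ (sublists l) (λ S → if length S ≡ᵇ j then term m S else 0q)) (sym (LP.applyUpTo-∷ʳ _ k)))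
          (ℚ-Sum.sum-sublists-∷ʳ (odds k) (suc (2 * k)) _)

  subsetSum-0 : ∀ k m → subsetSum 0 k m ≡ term m []
  subsetSum-0 zero    m = QP.+-identityʳ (term m [])
  subsetSum-0 (suc k) m = trans (subsetSum-suc 0 k m)
    (trans (cong (subsetSum 0 k m +q_) (ℚ-Sum.sum-zero (sublists (odds k))
             (λ S → cong (λ n → if n ≡ᵇ 0 then term m (S ++ suc (2 * k) ∷ []) else 0q) (length-∷ʳ S (suc (2 * k))))))
           (trans (QP.+-identityʳ _) (subsetSum-0 k m)))

  subsetSum-rec : ∀ j k m → 2 * k ≤ m →
    subsetSum (suc j) k m ≡ sumℚ (upTo k) (λ i → subsetSum j i (suc (2 * i)) *q expTerm (m ∸ suc (2 * i)))
  subsetSum-rec j zero    m le = QP.+-identityˡ 0q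
  subsetSum-rec j (suc k) m le = begin
      subsetSum (suc j) (suc k) m
    ≡⟨ subsetSum-suc (suc j) k m ⟩
      subsetSum (suc j) k m
        +q sumℚ (sublists (odds k)) (λ S → if length (S ++ s ∷ []) ≡ᵇ suc j then term m (S ++ s ∷ []) else 0q)
    ≡⟨ cong₂ _+q_ (subsetSum-rec j k m (NP.≤-trans (NP.m≤n+m (2 * k) 2) 2k+2≤m))
         (trans (ℚ-Sum.sum-cong-All (Chain-sublists 0 (odds k) s (Chain-odds k)) lastOdd)
                (sym (ℚ-Sum.sum-homo (_*q expTerm (m ∸ s)) (QP.*-zeroˡ (expTerm (m ∸ s))) (λ a b → QP.*-distribʳ-+ (expTerm (m ∸ s)) a b)
                                     (sublists (odds k)) (λ S → if length S ≡ᵇ j then term s S else 0q)))) ⟩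
      sumℚ (upTo k) f +q subsetSum j k s *q expTerm (m ∸ s)
    ≡⟨ sym (ℚ-Sum.sum-upTo-suc k f) ⟩
      sumℚ (upTo (suc k)) f
    ∎
    where
    open ≡-Reasoning
    s = suc (2 * k)
    f : ℕ → Q.ℚ
    f i = subsetSum j i (suc (2 * i)) *q expTerm (m ∸ suc (2 * i))
    2k+2≤m : 2 + 2 * k ≤ m
    2k+2≤m = subst (_≤ m) (NP.*-suc 2 k) le
    lastOdd : ∀ S → Chain 0 S s →
              (if length (S ++ s ∷ []) ≡ᵇ suc j then term m (S ++ s ∷ []) else 0q)
                ≡ (if length S ≡ᵇ j then term s S else 0q) *q expTerm (m ∸ s)
    lastOdd S c rewrite length-∷ʳ S s with length S ≡ᵇ j
    ... | true  = term-∷ʳ S s m c (NP.≤-trans (NP.n≤1+n s) 2k+2≤m)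
    ... | false = sym (QP.*-zeroˡ (expTerm (m ∸ s)))

  series : Series
  series j m = if isOdd m then subsetSum j (half m) m else 0q

  series-2* : ∀ j i → series j (2 * i) ≡ 0q
  series-2* j i = cong (λ b → if b then subsetSum j (half (2 * i)) (2 * i) else 0q) (isOdd-2* i)

  series-1+2* : ∀ j i → series j (suc (2 * i)) ≡ subsetSum j i (suc (2 * i))
  series-1+2* j i = trans (cong (λ b → if b then subsetSum j (half (suc (2 * i))) (suc (2 * i)) else 0q) (isOdd-1+2* i))
                          (cong (λ n → subsetSum j n (suc (2 * i))) (half-1+2* i))

  private
    convolution : ℕ → ℕ → Q.ℚ
    convolution j m = sumℚ (upTo (suc m)) (λ t → series j t *q coshTerm (m ∸ t))

    even-term : ∀ j m i → series j (2 * i) *q coshTerm (m ∸ 2 * i) ≡ 0q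
    even-term j m i = trans (cong (_*q coshTerm (m ∸ 2 * i)) (series-2* j i)) (QP.*-zeroˡ (coshTerm (m ∸ 2 * i)))

  series-suc-2* : ∀ j k → series (suc j) (2 * k) ≡ convolution j (2 * k)
  series-suc-2* j k = begin
      series (suc j) (2 * k)
    ≡⟨ series-2* (suc j) k ⟩
      0q
    ≡⟨ sym (trans (cong₂ _+q_ (ℚ-Sum.sum-upTo-zero k pair) (even-term j (2 * k) k)) (QP.+-identityˡ 0q)) ⟩
      sumℚ (upTo k) (λ i → F (2 * i) +q F (suc (2 * i))) +q F (2 * k)
    ≡⟨ cong (_+q F (2 * k)) (sym (ℚ-Sum.sum-upTo-pairs k F)) ⟩
      sumℚ (upTo (2 * k)) F +q F (2 * k)
    ≡⟨ sym (ℚ-Sum.sum-upTo-suc (2 * k) F) ⟩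
      convolution j (2 * k)
    ∎
    where
    open ≡-Reasoning
    F : ℕ → Q.ℚ
    F t = series j t *q coshTerm (2 * k ∸ t)
    pair : ∀ i → i < k → F (2 * i) +q F (suc (2 * i)) ≡ 0q
    pair i i<k = trans (cong₂ _+q_ (even-term j (2 * k) i)
                                   (trans (cong (λ b → series j (suc (2 * i)) *q (if b then expTerm (2 * k ∸ suc (2 * i)) else 0q))
                                                (isEvenPos-2*∸1+2* i k i<k))
                                          (QP.*-zeroʳ (series j (suc (2 * i))))))
                       (QP.+-identityˡ 0q)

  series-suc-1+2* : ∀ j k → series (suc j) (suc (2 * k)) ≡ convolution j (suc (2 * k))
  series-suc-1+2* j k = begin
      series (suc j) (suc (2 * k))
    ≡⟨ series-1+2* (suc j) k ⟩
      subsetSum (suc j) k (suc (2 * k))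
    ≡⟨ subsetSum-rec j k (suc (2 * k)) (NP.n≤1+n _) ⟩
      sumℚ (upTo k) (λ i → subsetSum j i (suc (2 * i)) *q expTerm (2 * k ∸ 2 * i))
    ≡⟨ ℚ-Sum.sum-upTo-cong k pair ⟩
      sumℚ (upTo k) G
    ≡⟨ sym (trans (ℚ-Sum.sum-upTo-suc k G) (trans (cong (sumℚ (upTo k) G +q_) last) (QP.+-identityʳ _))) ⟩
      sumℚ (upTo (suc k)) G
    ≡⟨ sym (ℚ-Sum.sum-upTo-pairs (suc k) F) ⟩
      sumℚ (upTo (2 * suc k)) F
    ≡⟨ cong (λ n → sumℚ (upTo n) F) (NP.*-suc 2 k) ⟩
      convolution j (suc (2 * k))
    ∎
    where
    open ≡-Reasoning
    F : ℕ → Q.ℚ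
    F t = series j t *q coshTerm (suc (2 * k) ∸ t)
    G : ℕ → Q.ℚ
    G i = F (2 * i) +q F (suc (2 * i))
    pair : ∀ i → i < k → subsetSum j i (suc (2 * i)) *q expTerm (2 * k ∸ 2 * i) ≡ G i
    pair i i<k = sym (trans (cong₂ _+q_ (even-term j (suc (2 * k)) i)
                                        (cong₂ _*q_ (series-1+2* j i)
                                                    (cong (λ b → if b then expTerm (2 * k ∸ 2 * i) else 0q) (isEvenPos-2*∸2* i k i<k))))
                            (QP.+-identityˡ _))
    last : G k ≡ 0q
    last = trans (cong₂ _+q_ (even-term j (suc (2 * k)) k)
                             (trans (cong (λ e → series j (suc (2 * k)) *q coshTerm e) (NP.n∸n≡0 (2 * k))) (QP.*-zeroʳ (series j (suc (2 * k))))))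
                 (QP.+-identityˡ 0q)

  series-suc : ∀ j m → series (suc j) m ≡ convolution j m
  series-suc j m with even⊎odd m
  ... | inj₁ (k , refl) = series-suc-2* j k
  ... | inj₂ (k , refl) = series-suc-1+2* j k

  sumOverOddSubsets≡subsetSum : (f : ℕ → List ℕ → Q.ℚ) → (∀ k S → Chain 0 S (suc (2 * k)) → f (suc k) S ≡ term (suc (2 * k)) S) →
                                ∀ j k → sumOverOddSubsets (suc k) j (f (suc k)) ≡ subsetSum j k (suc (2 * k))
  sumOverOddSubsets≡subsetSum f hf j k =
    trans (ℚ-Sum.sum-filter (λ S → length S ≡ᵇ j) (sublists (odds k)) (f (suc k)))
          (ℚ-Sum.sum-cong-All (Chain-sublists 0 (odds k) (suc (2 * k)) (Chain-odds k))
                              (λ S c → cong (λ t → if length S ≡ᵇ j then t else 0q) (hf k S c)))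

  oddSeq⋆denom : (f : ℕ → List ℕ → Q.ℚ) (σ : ℕ → Q.ℚ) (T : Series) →
                 (∀ k S → Chain 0 S (suc (2 * k)) → f (suc k) S ≡ term (suc (2 * k)) S) → (∀ m → term m [] ≡ σ m) →
                 (∀ m → T 0 m ≡ (if isOdd m then σ m else 0q)) → (∀ k m → T (suc k) m ≡ 0q) →
                 ∀ k m → ((λ j → oddSeq (λ n → sumOverOddSubsets n j (f n))) ⋆ denom) k m ≡ T k m
  oddSeq⋆denom f σ T hf term-[] hT0 hT = ⋆denom-solution L T L0 hT Lsuc
    where
    L : Series
    L j = oddSeq (λ n → sumOverOddSubsets n j (f n))
    L≡series : ∀ j m → L j m ≡ series j m
    L≡series j m = oddSeq-isOdd _ (λ m → subsetSum j (half m) m)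
                     (λ k → trans (sumOverOddSubsets≡subsetSum f hf j k)
                                  (cong (λ n → subsetSum j n (suc (2 * k))) (sym (half-1+2* k)))) m
    L0 : ∀ m → L 0 m ≡ T 0 m
    L0 m = trans (L≡series 0 m)
                 (trans (cong (λ x → if isOdd m then x else 0q) (trans (subsetSum-0 (half m) m) (term-[] m))) (sym (hT0 m)))
    Lsuc : ∀ j m → L (suc j) m ≡ sumℚ (upTo (suc m)) (λ t → L j t *q coshTerm (m ∸ t))
    Lsuc j m = trans (L≡series (suc j) m)
                     (trans (series-suc j m) (ℚ-Sum.sum-cong (upTo (suc m)) (λ t → cong (_*q coshTerm (m ∸ t)) (sym (L≡series j t)))))

2[1+k]∸1 : ∀ k → 2 * suc k ∸ 1 ≡ suc (2 * k)
2[1+k]∸1 k = cong (_∸ 1) (NP.*-suc 2 k)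

module Multinomial = OddSubsetSeries (λ _ _ → 0) (λ _ _ _ → refl) (λ _ _ _ → z≤n)

multinom*expTerm : ∀ m S → multinom m S *q expTerm m ≡ Multinomial.term m S
multinom*expTerm m S =
  trans (/-*-/ (m !) P (2 ^ m) (m !) {{prodFact≢0 (co m S)}} {{m !≢0}})
        (/-≡-cross (m ! * 2 ^ m) (P * m !) (2 ^ m) P {{NP.m*n≢0 P _ {{prodFact≢0 (co m S)}} {{m !≢0}}}} {{prodFact≢0 (co m S)}}
                    (lem (m !) (2 ^ m) P))
  where
  P = prodFact (co m S)
  lem : ∀ f t p → (f * t) * p ≡ t * (p * f)
  lem = solve 3 (λ f t p → (f :* t) :* p := t :* (p :* f)) refl

firstOr-∷ʳ : ∀ S s m → firstOr (S ++ s ∷ []) m ≡ firstOr S s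
firstOr-∷ʳ []      s m = refl
firstOr-∷ʳ (x ∷ S) s m = refl

module SignedPermutations = OddSubsetSeries firstOr firstOr-∷ʳ firstOr≤

alphaPlus/! : ∀ m S → Chain 0 S m → alphaPlus m S over! m ≡ SignedPermutations.term m S
alphaPlus/! m S c = /-≡-cross (alphaPlus m S) (m !) (2 ^ (m ∸ firstOr S m)) (prodFact (co m S)) {{m !≢0}} {{prodFact≢0 (co m S)}}
                               (trans (alphaPlus-formula m S c) (NP.*-comm (m !) _))

multinomial-series : (k m : ℕ) → (LHS₁ ⋆ denom) k m ≡ sinh2t k m
multinomial-series =
  Multinomial.oddSeq⋆denom (λ n S → multinom (2 * n ∸ 1) S *q expTerm (2 * n ∸ 1)) expTerm sinh2t
    (λ k S _ → trans (cong (λ M → multinom M S *q expTerm M) (2[1+k]∸1 k)) (multinom*expTerm (suc (2 * k)) S))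
    term-[] (λ _ → refl) (λ _ _ → refl)
  where
  term-[] : ∀ m → Multinomial.term m [] ≡ expTerm m
  term-[] m = /-≡-cross (2 ^ m) (m ! * 1) (2 ^ m) (m !) {{prodFact≢0 (co m [])}} {{m !≢0}}
                         (cong (2 ^ m *_) (sym (NP.*-identityʳ (m !))))

signedPermutation-series : (k m : ℕ) → (LHS₂ ⋆ denom) k m ≡ sinht k m
signedPermutation-series =
  SignedPermutations.oddSeq⋆denom (λ n S → alphaPlus (2 * n ∸ 1) S over! (2 * n ∸ 1)) (λ m → 1 over! m) sinht
    (λ k S c → trans (cong (λ M → alphaPlus M S over! M) (2[1+k]∸1 k)) (alphaPlus/! (suc (2 * k)) S c))
    term-[] (λ _ → refl) (λ _ _ → refl)
  where
  term-[] : ∀ m → SignedPermutations.term m [] ≡ 1 over! m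
  term-[] m = /-≡-cross (2 ^ (m ∸ m)) (m ! * 1) 1 (m !) {{prodFact≢0 (co m [])}} {{m !≢0}}
                         (trans (cong (λ e → 2 ^ e * m !) (NP.n∸n≡0 m)) (cong (1 *_) (sym (NP.*-identityʳ (m !)))))

lemma4p4 : ((k m : ℕ) → (LHS₁ ⋆ denom) k m ≡ sinh2t k m)
         × ((k m : ℕ) → (LHS₂ ⋆ denom) k m ≡ sinht k m)
lemma4p4 = multinomial-series , signedPermutation-series
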